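{- Let $n,r,s\ge 1$ be integers and let $k$ be defined by $2k+1=(2r+1)(2s+1)$. For $1\le a\le r$, set $I_a=\{(a-1)(2s+1)+1,\dots,a(2s+1)\}$, and set $M=\{r(2s+1)+1,\dots,(r+1)(2s+1)\}$. Let $G_{2n}(2r+1,2s+1)$ be the simple graph with vertex set $$\{u_i,v_i: 1\le i\le 2k+1\}\cup\{Y_{a,j},Z_{a,j}: 1\le a\le r,\ 1\le j\le 2n\}\cup\{X_j: 1\le j\le 2n\}$$ and edge set consisting of - $u_iv_i$ for $1\le i\le 2k+1$; - for each $1\le a\le r$, $1\le j\le 2n$ and $i\in I_a$: the edges $Y_{a,j}u_i$, $Y_{a,j}v_{2k+2-i}$, $Z_{a,j}v_i$, $Z_{a,j}u_{2k+2-i}$; - for each $1\le j\le 2n$ and $i\in M$: the edges $X_ju_i$ and $X_jv_{2k+2-i}$. (This graph is tripartite and has $r+1$ components.) Then $\chi_{la}(G_{2n}(2r+1,2s+1))=3$.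
   Context: For a graph $G$ with $q$ edges, a local antimagic labeling is a bijection $f:E(G)\to\{1,2,\dots,q\}$ such that $f^+(u)\ne f^+(v)$ for every edge $uv\in E(G)$. Here $f^+(u)=\sum_{e\ni u} f(e)$ is the sum of the labels of the edges incident to $u$. The color number of $f$ is the number of distinct values of $f^+$. The local antimagic chromatic number $\chi_{la}(G)$ is the minimum color number over all local antimagic labelings of $G$. -}

module Defs where

open import Data.Nat using (ℕ; zero; suc; _+_; _*_; _∸_; _≤_)
import Data.Nat.Properties as ℕP
open import Data.Fin using (Fin; toℕ)
open import Data.Fin.Permutation using (Permutation′; _⟨$⟩ʳ_)
open import Data.List using (List; []; _∷_; _++_; map; concatMap; applyUpTo; allFin; length; lookup; deduplicate)
open import Data.Nat.ListAction using (sum)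
open import Data.Product using (_×_; _,_; proj₁; proj₂; Σ; ∃)
open import Data.Bool using (Bool; true; false; if_then_else_; _∨_)
open import Relation.Nullary using (¬_; Dec; yes; no; does)
open import Relation.Binary.PropositionalEquality using (_≡_; _≢_; refl; cong; cong₂)
open import Relation.Binary.Definitions using (DecidableEquality)

record Graph : Set₁ where
  field
    Vtx      : Set
    _≟V_     : DecidableEquality Vtx
    vertices : List Vtx
    edges    : List (Vtx × Vtx)

  q : ℕ
  q = length edges

  edge : Fin q → Vtx × Vtx
  edge = lookup edges

  incident : Vtx → Vtx × Vtx → Bool
  incident w (x , y) = does (w ≟V x) ∨ does (w ≟V y)

-- An edge labeling: a bijection E(G) → {1,…,q}. Edges are indexed by Fin q;
-- a bijection Fin q ↔ Fin q, shifted by one, is a bijection onto {1,…,q}.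
Labeling : Graph → Set
Labeling G = Permutation′ (Graph.q G)

module _ (G : Graph) where
  open Graph G

  label : Labeling G → Fin q → ℕ
  label f e = suc (toℕ (f ⟨$⟩ʳ e))

  vsum : Labeling G → Vtx → ℕ
  vsum f w = sum (map (λ e → if incident w (edge e) then label f e else 0) (allFin q))

  IsLocalAntimagic : Labeling G → Set
  IsLocalAntimagic f = (e : Fin q) → vsum f (proj₁ (edge e)) ≢ vsum f (proj₂ (edge e))

  colorNumber : Labeling G → ℕ
  colorNumber f = length (deduplicate ℕP._≟_ (map (vsum f) vertices))

  χla≡ : ℕ → Set
  χla≡ c = (Σ (Labeling G) λ f → IsLocalAntimagic f × colorNumber f ≡ c)
         × ((f : Labeling G) → IsLocalAntimagic f → c ≤ colorNumber f)

data V : Set where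
  u v : ℕ → V
  Y Z : ℕ → ℕ → V
  X   : ℕ → V

_≟_ : DecidableEquality V
u i ≟ u j with ℕP._≟_ i j
... | yes refl = yes refl
... | no ne = no λ { refl → ne refl }
u _ ≟ v _ = no λ ()
u _ ≟ Y _ _ = no λ ()
u _ ≟ Z _ _ = no λ ()
u _ ≟ X _ = no λ ()
v _ ≟ u _ = no λ ()
v i ≟ v j with ℕP._≟_ i j
... | yes refl = yes refl
... | no ne = no λ { refl → ne refl }
v _ ≟ Y _ _ = no λ ()
v _ ≟ Z _ _ = no λ ()
v _ ≟ X _ = no λ ()
Y _ _ ≟ u _ = no λ ()
Y _ _ ≟ v _ = no λ ()
Y a i ≟ Y b j with ℕP._≟_ a b | ℕP._≟_ i j
... | yes refl | yes refl = yes refl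
... | no ne | _ = no λ { refl → ne refl }
... | yes _ | no ne = no λ { refl → ne refl }
Y _ _ ≟ Z _ _ = no λ ()
Y _ _ ≟ X _ = no λ ()
Z _ _ ≟ u _ = no λ ()
Z _ _ ≟ v _ = no λ ()
Z _ _ ≟ Y _ _ = no λ ()
Z a i ≟ Z b j with ℕP._≟_ a b | ℕP._≟_ i j
... | yes refl | yes refl = yes refl
... | no ne | _ = no λ { refl → ne refl }
... | yes _ | no ne = no λ { refl → ne refl }
Z _ _ ≟ X _ = no λ ()
X _ ≟ u _ = no λ ()
X _ ≟ v _ = no λ ()
X _ ≟ Y _ _ = no λ ()
X _ ≟ Z _ _ = no λ ()
X i ≟ X j with ℕP._≟_ i j
... | yes refl = yes refl
... | no ne = no λ { refl → ne refl }

-- [ a ⋯ b ] = the list a, a+1, …, b  (empty if b < a)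
[_⋯_] : ℕ → ℕ → List ℕ
[ a ⋯ b ] = applyUpTo (a +_) (suc b ∸ a)

module _ (n r s : ℕ) where
  -- K = 2k+1 = (2r+1)(2s+1); note 2k+2-i = K+1-i
  K : ℕ
  K = (2 * r + 1) * (2 * s + 1)

  I : ℕ → List ℕ
  I a = [ (a ∸ 1) * (2 * s + 1) + 1 ⋯ a * (2 * s + 1) ]

  M : List ℕ
  M = [ r * (2 * s + 1) + 1 ⋯ (r + 1) * (2 * s + 1) ]

  Gverts : List V
  Gverts = map u [ 1 ⋯ K ] ++ map v [ 1 ⋯ K ]
        ++ concatMap (λ a → map (Y a) [ 1 ⋯ 2 * n ]) [ 1 ⋯ r ]
        ++ concatMap (λ a → map (Z a) [ 1 ⋯ 2 * n ]) [ 1 ⋯ r ]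
        ++ map X [ 1 ⋯ 2 * n ]

  Gedges : List (V × V)
  Gedges = map (λ i → (u i , v i)) [ 1 ⋯ K ]
        ++ concatMap (λ a → concatMap (λ j → concatMap (λ i →
               (Y a j , u i) ∷ (Y a j , v (K + 1 ∸ i)) ∷ (Z a j , v i) ∷ (Z a j , u (K + 1 ∸ i)) ∷ [])
             (I a)) [ 1 ⋯ 2 * n ]) [ 1 ⋯ r ]
        ++ concatMap (λ j → concatMap (λ i →
               (X j , u i) ∷ (X j , v (K + 1 ∸ i)) ∷ []) M) [ 1 ⋯ 2 * n ]

  G2n : Graph
  G2n = record { Vtx = V ; _≟V_ = _≟_ ; vertices = Gverts ; edges = Gedges }

{-# OPTIONS --safe #-}
module Submission where

-- The graph is tripartite, with parts {u_x}, {v_y} and the level vertices Y_{a,j}, Z_{a,j}, X_j. The rung u_i v_i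
-- gets label i. At each level j, the edges from one level vertex to u_x and to v_{K+1-x} get labels adding up to
-- T = (4n + 2)K + 1, so every level vertex, which meets 2s + 1 such pairs, has the odd sum (2s + 1)T. Placing the
-- level labels in blocks of K consecutive numbers, with offset x or K + 1 - x alternately, gives every u_x the same
-- even sum A and every v_y the same even sum B < A. So three colours suffice, and three are needed because
-- u_c, v_c and X_1 form a triangle for the centre c = K + 1 - c of M. The labeling is a bijection because an edge is
-- determined by its key (its rung, or its level and its end u_x or v_y), and a key by the block and offset of its label.

open import Defs
open import Data.Nat using (ℕ; zero; suc; _+_; _*_; _∸_; _≤_; _<_; z≤n; s≤s; z<s; s<s; _<?_)
import Data.Nat.Properties as ℕ
open import Data.Nat.Tactic.RingSolver using (solve-∀)
open import Data.Nat.ListAction using (sum)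
open import Data.Nat.ListAction.Properties using (sum-++)
open import Data.Bool using (Bool; true; false; if_then_else_; _∨_)
open import Data.Bool.Properties using (∨-identityʳ)
open import Data.Empty using (⊥-elim)
open import Data.Sum using (_⊎_; inj₁; inj₂)
open import Data.Product using (_×_; _,_; proj₁; proj₂; ∃)
open import Data.Fin as Fin using (Fin; toℕ)
import Data.Fin.Properties as Finₚ
open import Data.List using (List; []; _∷_; _++_; map; concatMap; applyUpTo; allFin; length; lookup; deduplicate)
open import Data.List.Properties using (map-++; map-∘; map-cong; map-tabulate; tabulate-lookup; length-++)
open import Data.List.Relation.Unary.All as All using (All; []; _∷_)
import Data.List.Relation.Unary.All.Properties as Allₚ
open import Data.List.Relation.Unary.Any as Any using (here; there)
open import Data.List.Relation.Unary.Any.Properties using (lookup-index)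
open import Data.List.Relation.Unary.AllPairs using (AllPairs; []; _∷_)
open import Data.List.Relation.Unary.Unique.Propositional using (Unique)
open import Data.List.Relation.Unary.Unique.DecPropositional.Properties ℕ._≟_ using (deduplicate-!)
open import Data.List.Membership.Propositional using (_∈_; lose)
open import Data.List.Membership.Propositional.Properties
  using (∈-∃++; ∈-lookup; ∈-concatMap⁺; ∈-applyUpTo⁺; ∈-map⁺; ∈-map⁻; ∈-deduplicate⁺; ∈-deduplicate⁻;
         ∈-++⁺ˡ; ∈-++⁺ʳ)
open import Function.Bundles using (_↔_; mk↔ₛ′)
open import Function.Definitions using (Injective)
open import Relation.Nullary using (¬_; Dec; yes; no; does)
open import Relation.Nullary.Decidable using (dec-true; dec-false)
open import Relation.Binary.PropositionalEquality using (_≡_; _≢_; refl; cong; cong₂; sym; trans; subst; module ≡-Reasoning)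

open ≡-Reasoning

2*suc : ∀ t → 2 * suc t ≡ suc (suc (2 * t))
2*suc = solve-∀

reflect-∸ : ∀ a b k → k < b → a + b ∸ k ≡ suc (a + (b ∸ suc k))
reflect-∸ a b k k<b = trans (ℕ.+-∸-assoc a (ℕ.<⇒≤ k<b)) (trans (cong (a +_) (ℕ.+-∸-assoc 1 k<b)) (ℕ.+-suc a _))

block-offset-unique : ∀ K {b b′ o o′} → 1 ≤ o × o ≤ K → 1 ≤ o′ × o′ ≤ K →
                      b * K + o ≡ b′ * K + o′ → b ≡ b′ × o ≡ o′
block-offset-unique K {zero}  {zero}   _          _            eq = refl , eq
block-offset-unique K {zero}  {suc b′} (_ , o≤K) (1≤o′ , _) eq =
  ⊥-elim (ℕ.<⇒≱ (subst (K <_) (sym eq) (ℕ.≤-trans (ℕ.≤-reflexive (ℕ.+-comm 1 K))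
                                          (ℕ.+-mono-≤ (ℕ.m≤m+n K (b′ * K)) 1≤o′))) o≤K)
block-offset-unique K {suc b} {zero}   o∈ o′∈ eq
  with () ← proj₁ (block-offset-unique K {zero} {suc b} o′∈ o∈ (sym eq))
block-offset-unique K {suc b} {suc b′} o∈ o′∈ eq
  with refl , refl ← block-offset-unique K {b} {b′} o∈ o′∈
                       (ℕ.+-cancelˡ-≡ K _ _ (trans (sym (ℕ.+-assoc K (b * K) _)) (trans eq (ℕ.+-assoc K (b′ * K) _))))
  = refl , refl

isEven : ℕ → Bool
isEven zero          = true
isEven (suc zero)    = false
isEven (suc (suc j)) = isEven j

isEven-2* : ∀ t → isEven (2 * t) ≡ true
isEven-2* zero    = refl
isEven-2* (suc t) = trans (cong isEven (2*suc t)) (isEven-2* t)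

isEven-1+2* : ∀ t → isEven (suc (2 * t)) ≡ false
isEven-1+2* zero    = refl
isEven-1+2* (suc t) = trans (cong (λ j → isEven (suc j)) (2*suc t)) (isEven-1+2* t)

-- Sums over initial segments of ℕ

∑ : ℕ → (ℕ → ℕ) → ℕ
∑ zero    g = 0
∑ (suc n) g = g 0 + ∑ n (λ k → g (suc k))

∑-cong : ∀ n {g h : ℕ → ℕ} → (∀ k → k < n → g k ≡ h k) → ∑ n g ≡ ∑ n h
∑-cong zero    eq = refl
∑-cong (suc n) eq = cong₂ _+_ (eq 0 z<s) (∑-cong n (λ k k<n → eq (suc k) (s<s k<n)))

∑-+ : ∀ n (g h : ℕ → ℕ) → ∑ n (λ k → g k + h k) ≡ ∑ n g + ∑ n h
∑-+ zero    g h = refl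
∑-+ (suc n) g h = trans (cong (g 0 + h 0 +_) (∑-+ n (λ k → g (suc k)) (λ k → h (suc k))))
                        (interchange (g 0) (h 0) _ _)
  where
  interchange : ∀ a b c d → (a + b) + (c + d) ≡ (a + c) + (b + d)
  interchange = solve-∀

∑-*ˡ : ∀ n c (g : ℕ → ℕ) → ∑ n (λ k → c * g k) ≡ c * ∑ n g
∑-*ˡ zero    c g = sym (ℕ.*-zeroʳ c)
∑-*ˡ (suc n) c g = trans (cong (c * g 0 +_) (∑-*ˡ n c (λ k → g (suc k))))
                         (sym (ℕ.*-distribˡ-+ c (g 0) _))

∑-*ʳ : ∀ n c (g : ℕ → ℕ) → ∑ n (λ k → g k * c) ≡ ∑ n g * c
∑-*ʳ n c g = begin
  ∑ n (λ k → g k * c) ≡⟨ ∑-cong n (λ k _ → ℕ.*-comm (g k) c) ⟩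
  ∑ n (λ k → c * g k) ≡⟨ ∑-*ˡ n c g ⟩
  c * ∑ n g           ≡⟨ ℕ.*-comm c _ ⟩
  ∑ n g * c           ∎

∑-const : ∀ n c → ∑ n (λ _ → c) ≡ n * c
∑-const zero    c = refl
∑-const (suc n) c = cong (c +_) (∑-const n c)

∑-zero : ∀ n → ∑ n (λ _ → 0) ≡ 0
∑-zero n = trans (∑-const n 0) (ℕ.*-zeroʳ n)

∑-split : ∀ a b (g : ℕ → ℕ) → ∑ (a + b) g ≡ ∑ a g + ∑ b (λ k → g (a + k))
∑-split zero    b g = refl
∑-split (suc a) b g = trans (cong (g 0 +_) (∑-split a b (λ k → g (suc k))))
                            (sym (ℕ.+-assoc (g 0) _ _))

∑-blocks : ∀ r m (g : ℕ → ℕ) → ∑ r (λ a → ∑ m (λ t → g (a * m + t))) ≡ ∑ (r * m) g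
∑-blocks zero    m g = refl
∑-blocks (suc r) m g = begin
  ∑ m g + ∑ r (λ a → ∑ m (λ t → g (m + a * m + t)))
    ≡⟨ cong (∑ m g +_) (∑-cong r (λ a _ → ∑-cong m (λ t _ → cong g (ℕ.+-assoc m (a * m) t)))) ⟩
  ∑ m g + ∑ r (λ a → ∑ m (λ t → g (m + (a * m + t))))
    ≡⟨ cong (∑ m g +_) (∑-blocks r m (λ k → g (m + k))) ⟩
  ∑ m g + ∑ (r * m) (λ k → g (m + k))
    ≡⟨ sym (∑-split m (r * m) g) ⟩
  ∑ (m + r * m) g ∎

∑-swap : ∀ a b (f : ℕ → ℕ → ℕ) → ∑ a (λ i → ∑ b (λ j → f i j)) ≡ ∑ b (λ j → ∑ a (λ i → f i j))
∑-swap zero    b f = sym (∑-zero b)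
∑-swap (suc a) b f = begin
  ∑ b (f 0) + ∑ a (λ i → ∑ b (f (suc i)))
    ≡⟨ cong (∑ b (f 0) +_) (∑-swap a b (λ i → f (suc i))) ⟩
  ∑ b (f 0) + ∑ b (λ j → ∑ a (λ i → f (suc i) j))
    ≡⟨ sym (∑-+ b (f 0) _) ⟩
  ∑ b (λ j → f 0 j + ∑ a (λ i → f (suc i) j)) ∎

∑-last : ∀ n (g : ℕ → ℕ) → ∑ (suc n) g ≡ ∑ n g + g n
∑-last zero    g = ℕ.+-identityʳ (g 0)
∑-last (suc n) g = trans (cong (g 0 +_) (∑-last n (λ k → g (suc k))))
                         (sym (ℕ.+-assoc (g 0) _ _))

∑-reverse : ∀ n (g : ℕ → ℕ) → ∑ n (λ k → g (n ∸ suc k)) ≡ ∑ n g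
∑-reverse zero    g = refl
∑-reverse (suc n) g = begin
  g n + ∑ n (λ k → g (n ∸ suc k)) ≡⟨ cong (g n +_) (∑-reverse n g) ⟩
  g n + ∑ n g                     ≡⟨ ℕ.+-comm (g n) _ ⟩
  ∑ n g + g n                     ≡⟨ sym (∑-last n g) ⟩
  ∑ (suc n) g                     ∎

∑-pairs : ∀ n (g : ℕ → ℕ) → ∑ (2 * n) g ≡ ∑ n (λ t → g (2 * t) + g (suc (2 * t)))
∑-pairs zero    g = refl
∑-pairs (suc n) g = begin
  ∑ (2 * suc n) g
    ≡⟨ cong (λ k → ∑ k g) (2*suc n) ⟩
  g 0 + (g 1 + ∑ (2 * n) (λ k → g (suc (suc k))))
    ≡⟨ sym (ℕ.+-assoc (g 0) (g 1) _) ⟩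
  g 0 + g 1 + ∑ (2 * n) (λ k → g (suc (suc k)))
    ≡⟨ cong (g 0 + g 1 +_) (∑-pairs n (λ k → g (suc (suc k)))) ⟩
  g 0 + g 1 + ∑ n (λ t → g (suc (suc (2 * t))) + g (suc (suc (suc (2 * t)))))
    ≡⟨ cong (g 0 + g 1 +_) (∑-cong n (λ t _ → cong (λ k → g k + g (suc k)) (sym (2*suc t)))) ⟩
  g 0 + g 1 + ∑ n (λ t → g (2 * suc t) + g (suc (2 * suc t))) ∎

δ : ℕ → ℕ → ℕ
δ zero    zero    = 1
δ zero    (suc b) = 0
δ (suc a) zero    = 0
δ (suc a) (suc b) = δ a b

δ-refl : ∀ a → δ a a ≡ 1
δ-refl zero    = refl
δ-refl (suc a) = δ-refl a

δ-≢ : ∀ {a b} → a ≢ b → δ a b ≡ 0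
δ-≢ {zero}  {zero}  a≢b = ⊥-elim (a≢b refl)
δ-≢ {zero}  {suc b} a≢b = refl
δ-≢ {suc a} {zero}  a≢b = refl
δ-≢ {suc a} {suc b} a≢b = δ-≢ (λ a≡b → a≢b (cong suc a≡b))

δ-subst : ∀ a b (g : ℕ → ℕ) → δ a b * g b ≡ δ a b * g a
δ-subst a b g with a ℕ.≟ b
... | yes refl = refl
... | no  a≢b  = trans (cong (_* g b) (δ-≢ a≢b)) (sym (cong (_* g a) (δ-≢ a≢b)))

if-δ : ∀ {P : Set} (P? : Dec P) {a b} → (P → a ≡ b) → (a ≡ b → P) → ∀ c → (if does P? then c else 0) ≡ δ a b * c
if-δ (yes p) {a} to _ c = sym (trans (cong (_* c) (trans (cong (δ a) (sym (to p))) (δ-refl a))) (ℕ.+-identityʳ c))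
if-δ (no ¬p) _ from c = sym (cong (_* c) (δ-≢ (λ a≡b → ¬p (from a≡b))))

if-δ₂ : ∀ {P : Set} (P? : Dec P) {a b c d} → (P → a ≡ b × c ≡ d) → (a ≡ b → c ≡ d → P) → ∀ e →
        (if does P? then e else 0) ≡ δ a b * (δ c d * e)
if-δ₂ (yes p) {a} {c = c} to _ e with to p
... | refl , refl = sym (trans (cong₂ (λ x y → x * (y * e)) (δ-refl a) (δ-refl c)) (trans (ℕ.+-identityʳ _) (ℕ.+-identityʳ e)))
if-δ₂ (no ¬p) {a} {b} {c} {d} _ from e with a ℕ.≟ b
... | yes refl = sym (trans (cong (λ x → δ a a * (x * e)) (δ-≢ (λ c≡d → ¬p (from refl c≡d)))) (ℕ.*-zeroʳ (δ a a)))
... | no  a≢b  = sym (cong (_* (δ c d * e)) (δ-≢ a≢b))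

∑-δ-out : ∀ N c z → z < c ⊎ c + N ≤ z → ∑ N (λ k → δ z (c + k)) ≡ 0
∑-δ-out zero    c z _ = refl
∑-δ-out (suc N) c z out =
  cong₂ _+_ (δ-≢ (λ z≡c → head-out (trans z≡c (ℕ.+-identityʳ c)) out))
            (trans (∑-cong N (λ k _ → cong (δ z) (ℕ.+-suc c k))) (∑-δ-out N (suc c) z (tail-out out)))
  where
  head-out : ∀ {z c} → z ≡ c → ¬ (z < c ⊎ c + suc N ≤ z)
  head-out refl (inj₁ z<z)  = ℕ.<-irrefl refl z<z
  head-out refl (inj₂ z<z) = ℕ.<-irrefl refl (ℕ.<-≤-trans (ℕ.m<m+n _ z<s) z<z)
  tail-out : z < c ⊎ c + suc N ≤ z → z < suc c ⊎ suc c + N ≤ z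
  tail-out (inj₁ z<c) = inj₁ (ℕ.m<n⇒m<1+n z<c)
  tail-out (inj₂ le)  = inj₂ (subst (_≤ z) (ℕ.+-suc c N) le)

∑-δ-in : ∀ N c z → c ≤ z → z < c + N → ∑ N (λ k → δ z (c + k)) ≡ 1
∑-δ-in zero    c z c≤z z<c = ⊥-elim (ℕ.<-irrefl refl (ℕ.<-≤-trans (subst (z <_) (ℕ.+-identityʳ c) z<c) c≤z))
∑-δ-in (suc N) c z c≤z z<c+N with z ℕ.≟ c
... | yes refl = cong₂ _+_ (trans (cong (δ z) (ℕ.+-identityʳ z)) (δ-refl z))
                           (trans (∑-cong N (λ k _ → cong (δ z) (ℕ.+-suc z k))) (∑-δ-out N (suc z) z (inj₁ ℕ.≤-refl)))
... | no z≢c  = cong₂ _+_ (δ-≢ (λ e → z≢c (trans e (ℕ.+-identityʳ c))))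
                          (trans (∑-cong N (λ k _ → cong (δ z) (ℕ.+-suc c k)))
                                 (∑-δ-in N (suc c) z (ℕ.≤∧≢⇒< c≤z (λ e → z≢c (sym e)))
                                                     (subst (z <_) (ℕ.+-suc c N) z<c+N)))

∑-select : ∀ N {z} (g : ℕ → ℕ) → 1 ≤ z → z ≤ N → ∑ N (λ k → δ z (suc k) * g (suc k)) ≡ g z
∑-select N {z} g 1≤z z≤N = begin
  ∑ N (λ k → δ z (suc k) * g (suc k)) ≡⟨ ∑-cong N (λ k _ → δ-subst z (suc k) g) ⟩
  ∑ N (λ k → δ z (suc k) * g z)       ≡⟨ ∑-*ʳ N (g z) (λ k → δ z (suc k)) ⟩
  ∑ N (λ k → δ z (suc k)) * g z       ≡⟨ cong (_* g z) (∑-δ-in N 1 z 1≤z (s≤s z≤N)) ⟩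
  1 * g z                             ≡⟨ ℕ.*-identityˡ (g z) ⟩
  g z                                 ∎

∑-select₂ : ∀ M N {a b} c → 1 ≤ a → a ≤ M → 1 ≤ b → b ≤ N →
            ∑ M (λ i → ∑ N (λ j → δ a (suc i) * (δ b (suc j) * c))) ≡ c
∑-select₂ M N {a} {b} c 1≤a a≤M 1≤b b≤N =
  trans (∑-cong M (λ i _ → trans (∑-*ˡ N (δ a (suc i)) (λ j → δ b (suc j) * c))
                                 (cong (δ a (suc i) *_) (∑-select N (λ _ → c) 1≤b b≤N))))
        (∑-select M (λ _ → c) 1≤a a≤M)

module _ {A : Set} where

  sum-map-++ : ∀ (F : A → ℕ) xs ys → sum (map F (xs ++ ys)) ≡ sum (map F xs) + sum (map F ys)
  sum-map-++ F xs ys = trans (cong sum (map-++ F xs ys)) (sum-++ (map F xs) (map F ys))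

  sum-map-concatMap : ∀ {B : Set} (F : A → ℕ) (f : B → List A) xs →
                      sum (map F (concatMap f xs)) ≡ sum (map (λ x → sum (map F (f x))) xs)
  sum-map-concatMap F f []       = refl
  sum-map-concatMap F f (x ∷ xs) = trans (sum-map-++ F (f x) (concatMap f xs))
                                         (cong (sum (map F (f x)) +_) (sum-map-concatMap F f xs))

  sum-map-applyUpTo : ∀ (F : A → ℕ) (f : ℕ → A) n → sum (map F (applyUpTo f n)) ≡ ∑ n (λ k → F (f k))
  sum-map-applyUpTo F f zero    = refl
  sum-map-applyUpTo F f (suc n) = cong (F (f 0) +_) (sum-map-applyUpTo F (λ k → f (suc k)) n)

  sum-map-lookup : ∀ (F : A → ℕ) xs → sum (map (λ e → F (lookup xs e)) (allFin (length xs))) ≡ sum (map F xs)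
  sum-map-lookup F xs = cong sum (trans (map-tabulate (λ e → e) (λ e → F (lookup xs e)))
                                        (trans (sym (map-tabulate (lookup xs) F)) (cong (map F) (tabulate-lookup xs))))

  length≡sum : ∀ (xs : List A) → length xs ≡ sum (map (λ _ → 1) xs)
  length≡sum []       = refl
  length≡sum (x ∷ xs) = cong suc (length≡sum xs)

  module _ {B : Set} (h : A → B) where

    lookup-injective : ∀ {xs} → AllPairs (λ x y → h x ≢ h y) xs →
                       ∀ i j → h (lookup xs i) ≡ h (lookup xs j) → i ≡ j
    lookup-injective (_  ∷ _)   Fin.zero    Fin.zero    _  = refl
    lookup-injective (px ∷ _)   Fin.zero    (Fin.suc j) eq = ⊥-elim (All.lookup px (∈-lookup j) eq)
    lookup-injective (px ∷ _)   (Fin.suc i) Fin.zero    eq = ⊥-elim (All.lookup px (∈-lookup i) (sym eq))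
    lookup-injective (_  ∷ pxs) (Fin.suc i) (Fin.suc j) eq = cong Fin.suc (lookup-injective pxs i j eq)

    count≤1⇒distinct : (χ : B → B → ℕ) → (∀ b → χ b b ≡ 1) → ∀ xs →
                       (∀ {x} → x ∈ xs → sum (map (λ y → χ (h x) (h y)) xs) ≤ 1) →
                       AllPairs (λ x y → h x ≢ h y) xs
    count≤1⇒distinct χ χ-refl []       _     = []
    count≤1⇒distinct χ χ-refl (x ∷ xs) count = All.tabulate x≢ ∷ count≤1⇒distinct χ χ-refl xs count-xs
      where
      count-xs : ∀ {y} → y ∈ xs → sum (map (λ z → χ (h y) (h z)) xs) ≤ 1
      count-xs y∈ = ℕ.≤-trans (ℕ.m≤n+m _ _) (count (there y∈))
      others-zero : sum (map (λ z → χ (h x) (h z)) xs) ≡ 0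
      others-zero = ℕ.n≤0⇒n≡0 (ℕ.+-cancelˡ-≤ 1 _ 0 (subst (λ c → c + sum (map (λ z → χ (h x) (h z)) xs) ≤ 1)
                                                      (χ-refl (h x)) (count (here refl))))
      summand-zero : ∀ ys → sum (map (λ z → χ (h x) (h z)) ys) ≡ 0 → ∀ {y} → y ∈ ys → χ (h x) (h y) ≡ 0
      summand-zero (y ∷ ys) eq (here refl) = ℕ.m+n≡0⇒m≡0 _ eq
      summand-zero (y ∷ ys) eq (there y∈) = summand-zero ys (ℕ.m+n≡0⇒n≡0 (χ (h x) (h y)) eq) y∈
      x≢ : ∀ {y} → y ∈ xs → h x ≢ h y
      x≢ y∈ hx≡hy = ℕ.1+n≢0 (trans (sym (χ-refl (h x))) (trans (cong (χ (h x)) hx≡hy) (summand-zero xs others-zero y∈)))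

  unique-length-≤ : ∀ {xs ys : List A} → Unique xs → (∀ {x} → x ∈ xs → x ∈ ys) → length xs ≤ length ys
  unique-length-≤ {[]}     _           _  = z≤n
  unique-length-≤ {x ∷ xs} {ys} (x∉ ∷ uq) xs⊆ys with ∈-∃++ (xs⊆ys (here refl))
  ... | as , bs , refl = subst (suc (length xs) ≤_) (sym length-as++x∷bs)
                               (s≤s (unique-length-≤ uq λ y∈ → remove (xs⊆ys (there y∈)) (λ y≡x → All.lookup x∉ y∈ (sym y≡x))))
    where
    length-as++x∷bs : length (as ++ x ∷ bs) ≡ suc (length (as ++ bs))
    length-as++x∷bs = trans (length-++ as) (trans (ℕ.+-suc (length as) (length bs)) (cong suc (sym (length-++ as))))
    remove : ∀ {y} {as} → y ∈ as ++ x ∷ bs → y ≢ x → y ∈ as ++ bs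
    remove {as = []}     (here y≡x) y≢x = ⊥-elim (y≢x y≡x)
    remove {as = []}     (there y∈) _   = y∈
    remove {as = a ∷ as} (here y≡a) _   = here y≡a
    remove {as = a ∷ as} (there y∈) y≢x = there (remove y∈ y≢x)

injective⇒preimage : ∀ {N} {f : Fin N → Fin N} → Injective _≡_ _≡_ f → ∀ i → ∃ λ j → f j ≡ i
injective⇒preimage {suc N} {f} f-inj i with Finₚ.any? (λ j → f j Finₚ.≟ i)
... | yes found = found
... | no  none  = ⊥-elim (ℕ.1+n≰n (Finₚ.injective⇒≤ {f = f-punched} f-punched-injective))
  where
  i≢f : ∀ j → i ≢ f j
  i≢f j i≡fj = none (j , sym i≡fj)
  f-punched : Fin (suc N) → Fin N
  f-punched j = Fin.punchOut (i≢f j)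
  f-punched-injective : Injective _≡_ _≡_ f-punched
  f-punched-injective {a} {b} eq = f-inj (Finₚ.punchOut-injective (i≢f a) (i≢f b) eq)

injective⇒permutation : ∀ {N} (f : Fin N → Fin N) → Injective _≡_ _≡_ f → Fin N ↔ Fin N
injective⇒permutation f f-inj = mk↔ₛ′ f (λ i → proj₁ (injective⇒preimage f-inj i))
                                        (λ i → proj₂ (injective⇒preimage f-inj i))
                                        (λ j → f-inj (proj₂ (injective⇒preimage f-inj (f j))))

applyUpTo-cong : ∀ {A : Set} {f g : ℕ → A} → (∀ k → f k ≡ g k) → ∀ n → applyUpTo f n ≡ applyUpTo g n
applyUpTo-cong f≗g zero    = refl
applyUpTo-cong f≗g (suc n) = cong₂ _∷_ (f≗g 0) (applyUpTo-cong (λ k → f≗g (suc k)) n)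

∈-concatMap : ∀ {A B : Set} {f : A → List B} {x xs y} → x ∈ xs → y ∈ f x → y ∈ concatMap f xs
∈-concatMap {f = f} x∈xs y∈fx = ∈-concatMap⁺ f (lose x∈xs y∈fx)

-- a label ℓ ∈ [1, q] as the index ℓ - 1 of Fin q
fromLabel : ∀ {ℓ q} → 1 ≤ ℓ → ℓ ≤ q → Fin q
fromLabel {suc ℓ} _ ℓ<q = Fin.fromℕ< ℓ<q

suc-toℕ-fromLabel : ∀ {ℓ q} (1≤ℓ : 1 ≤ ℓ) (ℓ≤q : ℓ ≤ q) → suc (toℕ (fromLabel 1≤ℓ ℓ≤q)) ≡ ℓ
suc-toℕ-fromLabel {suc ℓ} _ ℓ<q = cong suc (Finₚ.toℕ-fromℕ< ℓ<q)

module _ (Γ : Graph) (f : Labeling Γ) where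
  open Graph Γ

  antimagic-endpoints : IsLocalAntimagic Γ f → ∀ {x y} → (x , y) ∈ edges → vsum Γ f x ≢ vsum Γ f y
  antimagic-endpoints antimagic xy∈ =
    subst (λ e → vsum Γ f (proj₁ e) ≢ vsum Γ f (proj₂ e)) (sym (lookup-index xy∈)) (antimagic (Any.index xy∈))

  colorNumber-≤ : ∀ (cs : List ℕ) → (∀ {w} → w ∈ vertices → vsum Γ f w ∈ cs) → colorNumber Γ f ≤ length cs
  colorNumber-≤ cs values = unique-length-≤ (deduplicate-! (map (vsum Γ f) vertices)) c∈cs
    where
    c∈cs : ∀ {c} → c ∈ deduplicate ℕ._≟_ (map (vsum Γ f) vertices) → c ∈ cs
    c∈cs c∈ with _ , w∈ , refl ← ∈-map⁻ (vsum Γ f) (∈-deduplicate⁻ ℕ._≟_ (map (vsum Γ f) vertices) c∈) = values w∈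

  3≤colorNumber : ∀ {x y z} → x ∈ vertices → y ∈ vertices → z ∈ vertices →
                  vsum Γ f x ≢ vsum Γ f y → vsum Γ f x ≢ vsum Γ f z → vsum Γ f y ≢ vsum Γ f z → 3 ≤ colorNumber Γ f
  3≤colorNumber x∈ y∈ z∈ x≢y x≢z y≢z =
    unique-length-≤ ((x≢y ∷ x≢z ∷ []) ∷ (y≢z ∷ []) ∷ [] ∷ []) λ where
      (here refl)                 → in-values x∈
      (there (here refl))         → in-values y∈
      (there (there (here refl))) → in-values z∈
    where
    in-values : ∀ {w} → w ∈ vertices → vsum Γ f w ∈ deduplicate ℕ._≟_ (map (vsum Γ f) vertices)
    in-values w∈ = ∈-deduplicate⁺ ℕ._≟_ (∈-map⁺ (vsum Γ f) w∈)

⋯-applyUpTo : ∀ c d e → e ≡ c + d → [ c + 1 ⋯ e ] ≡ applyUpTo (λ k → suc (c + k)) d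
⋯-applyUpTo c d e refl = trans (cong (applyUpTo ((c + 1) +_)) length-eq)
                               (applyUpTo-cong (λ k → trans (ℕ.+-assoc c 1 k) (ℕ.+-suc c k)) d)
  where
  length-eq : suc (c + d) ∸ (c + 1) ≡ d
  length-eq = trans (cong (suc (c + d) ∸_) (ℕ.+-comm c 1)) (ℕ.m+n∸m≡n c d)

∈-⋯ : ∀ c d e → e ≡ c + d → ∀ {k} → k < d → suc (c + k) ∈ [ c + 1 ⋯ e ]
∈-⋯ c d e e≡c+d k<d = subst (_ ∈_) (sym (⋯-applyUpTo c d e e≡c+d)) (∈-applyUpTo⁺ (λ k → suc (c + k)) k<d)

sum-map-⋯ : ∀ (g : ℕ → ℕ) c d e → e ≡ c + d → sum (map g [ c + 1 ⋯ e ]) ≡ ∑ d (λ k → g (suc (c + k)))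
sum-map-⋯ g c d e e≡c+d = trans (cong (λ xs → sum (map g xs)) (⋯-applyUpTo c d e e≡c+d))
                                (sum-map-applyUpTo g (λ k → suc (c + k)) d)

All-⋯ : ∀ {P : ℕ → Set} c d e → e ≡ c + d → (∀ k → k < d → P (suc (c + k))) → All P [ c + 1 ⋯ e ]
All-⋯ {P} c d e e≡c+d Pf = subst (All P) (sym (⋯-applyUpTo c d e e≡c+d)) (Allₚ.applyUpTo⁺₁ _ d (λ {k} k<d → Pf k k<d))

module _ {A : Set} (f : ℕ → List A) (c d e : ℕ) (e≡c+d : e ≡ c + d) where

  sum-concatMap-⋯ : ∀ (F : A → ℕ) → sum (map F (concatMap f [ c + 1 ⋯ e ])) ≡ ∑ d (λ k → sum (map F (f (suc (c + k)))))
  sum-concatMap-⋯ F = trans (sum-map-concatMap F f [ c + 1 ⋯ e ]) (sum-map-⋯ (λ x → sum (map F (f x))) c d e e≡c+d)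

  All-concatMap-⋯ : ∀ {P : A → Set} → (∀ k → k < d → All P (f (suc (c + k)))) → All P (concatMap f [ c + 1 ⋯ e ])
  All-concatMap-⋯ Pf = Allₚ.concat⁺ (Allₚ.map⁺ (All-⋯ c d e e≡c+d Pf))

-- rungKey i is the rung u_i v_i; uKey j x (vKey j y) is the edge joining u_x (v_y) to its neighbour at level j.
data Key : Set where
  rungKey    : ℕ → Key
  uKey vKey  : ℕ → ℕ → Key

level : V → ℕ
level (Y _ j) = j
level (Z _ j) = j
level (X j)   = j
level _       = 0

key : V × V → Key
key (u i , _) = rungKey i
key (w , u x) = uKey (level w) x
key (w , v y) = vKey (level w) y
key _         = rungKey 0  -- not an edge of G

module Construction (n r s : ℕ) where

  m : ℕ
  m = 2 * s + 1

  K′ : ℕ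
  K′ = K n r s

  mirror : ℕ → ℕ
  mirror i = K′ + 1 ∸ i

  G : List (V × V)
  G = Gedges n r s

  quad : ℕ → ℕ → ℕ → List (V × V)
  quad a j i = (Y a j , u i) ∷ (Y a j , v (mirror i)) ∷ (Z a j , v i) ∷ (Z a j , u (mirror i)) ∷ []

  pair : ℕ → ℕ → List (V × V)
  pair j i = (X j , u i) ∷ (X j , v (mirror i)) ∷ []

  quadSum : (V × V → ℕ) → ℕ → ℕ → ℕ → ℕ
  quadSum F a j i = sum (map F (quad a j i))

  pairSum : (V × V → ℕ) → ℕ → ℕ → ℕ
  pairSum F j i = sum (map F (pair j i))

  -- G is, definitionally, rungs ++ quads ++ pairs.
  rungs quads pairs : List (V × V)
  rungs = map (λ i → (u i , v i)) [ 1 ⋯ K′ ]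
  quads = concatMap (λ a → concatMap (λ j → concatMap (quad a j) (I n r s a)) [ 1 ⋯ 2 * n ]) [ 1 ⋯ r ]
  pairs = concatMap (λ j → concatMap (pair j) (M n r s)) [ 1 ⋯ 2 * n ]

  I-end : ∀ a → suc a * m ≡ a * m + m
  I-end a = ℕ.+-comm m (a * m)

  M-end : (r + 1) * m ≡ r * m + m
  M-end = trans (ℕ.*-distribʳ-+ m r 1) (cong (r * m +_) (ℕ.*-identityˡ m))

  rungPart quadPart pairPart : (V × V → ℕ) → ℕ
  rungPart F = ∑ K′ (λ k → F (u (suc k) , v (suc k)))
  quadPart F = ∑ r (λ a → ∑ (2 * n) (λ j → ∑ m (λ t → quadSum F (suc a) (suc j) (suc (a * m + t)))))
  pairPart F = ∑ (2 * n) (λ j → ∑ m (λ t → pairSum F (suc j) (suc (r * m + t))))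

  sum-edges : ∀ F → sum (map F G) ≡ rungPart F + (quadPart F + pairPart F)
  sum-edges F = trans (sum-map-++ F rungs (quads ++ pairs))
                      (cong₂ _+_ sum-rungs (trans (sum-map-++ F quads pairs) (cong₂ _+_ sum-quads sum-pairs)))
    where
    sum-rungs : sum (map F rungs) ≡ rungPart F
    sum-rungs = trans (cong sum (sym (map-∘ [ 1 ⋯ K′ ]))) (sum-map-⋯ (λ i → F (u i , v i)) 0 K′ K′ refl)
    sum-quads : sum (map F quads) ≡ quadPart F
    sum-quads = trans (sum-concatMap-⋯ _ 0 r r refl F) (∑-cong r (λ a _ →
                  trans (sum-concatMap-⋯ _ 0 (2 * n) (2 * n) refl F) (∑-cong (2 * n) (λ j _ →
                    sum-concatMap-⋯ _ (a * m) m (suc a * m) (I-end a) F))))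
    sum-pairs : sum (map F pairs) ≡ pairPart F
    sum-pairs = trans (sum-concatMap-⋯ _ 0 (2 * n) (2 * n) refl F) (∑-cong (2 * n) (λ j _ →
                  sum-concatMap-⋯ _ (r * m) m ((r + 1) * m) M-end F))

  K′≡ : K′ ≡ r * m + m + r * m
  K′≡ = lemma r s
    where
    lemma : ∀ r s → (2 * r + 1) * (2 * s + 1) ≡ r * (2 * s + 1) + (2 * s + 1) + r * (2 * s + 1)
    lemma = solve-∀

  InK : ℕ → Set
  InK i = 1 ≤ i × i ≤ K′

  InL : ℕ → Set
  InL j = 1 ≤ j × j ≤ 2 * n

  quad-index : ∀ {a t} → a < r → t < m → InK (suc (a * m + t))
  quad-index {a} {t} a<r t<m =
    s≤s z≤n , ℕ.≤-trans a*m+t<r*m (ℕ.≤-trans (ℕ.m≤m+n (r * m) m) (ℕ.≤-trans (ℕ.m≤m+n _ (r * m)) (ℕ.≤-reflexive (sym K′≡))))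
    where
    a*m+t<r*m : suc (a * m + t) ≤ r * m
    a*m+t<r*m = ℕ.≤-trans (ℕ.+-monoʳ-< (a * m) t<m) (subst (_≤ r * m) (ℕ.+-comm m (a * m)) (ℕ.*-monoˡ-≤ m a<r))

  pair-index : ∀ {t} → t < m → InK (suc (r * m + t))
  pair-index t<m =
    s≤s z≤n , ℕ.≤-trans (ℕ.+-monoʳ-< (r * m) t<m) (ℕ.≤-trans (ℕ.m≤m+n (r * m + m) (r * m)) (ℕ.≤-reflexive (sym K′≡)))

  mirror-involutive : ∀ {i} → InK i → mirror (mirror i) ≡ i
  mirror-involutive (_ , i≤K′) = ℕ.m∸[m∸n]≡n (ℕ.m≤n⇒m≤n+o 1 i≤K′)

  mirror-injective : ∀ {i i′} → InK i → InK i′ → mirror i ≡ mirror i′ → i ≡ i′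
  mirror-injective i∈K i′∈K eq = trans (sym (mirror-involutive i∈K)) (trans (cong mirror eq) (mirror-involutive i′∈K))

  mirror-suc : ∀ k → mirror (suc k) ≡ K′ ∸ k
  mirror-suc k = cong (_∸ suc k) (ℕ.+-comm K′ 1)

  mirror-InK : ∀ {i} → InK i → InK (mirror i)
  mirror-InK {suc i} (_ , i<K′) = subst (1 ≤_) (sym (ℕ.+-∸-comm 1 i<K′)) (ℕ.m≤n+m 1 _)
                                , subst (_≤ K′) (sym (mirror-suc i)) (ℕ.m∸n≤m K′ i)

  mirror-top : ∀ {k} → k < r * m → mirror (suc k) ≡ suc (r * m + m + (r * m ∸ suc k))
  mirror-top {k} k<R = trans (mirror-suc k) (trans (cong (_∸ k) K′≡) (reflect-∸ (r * m + m) (r * m) k k<R))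

  mirror-mid : ∀ {t} → t < m → mirror (suc (r * m + t)) ≡ suc (r * m + (m ∸ suc t))
  mirror-mid {t} t<m = begin
    mirror (suc (r * m + t))        ≡⟨ mirror-suc (r * m + t) ⟩
    K′ ∸ (r * m + t)                ≡⟨ cong (_∸ (r * m + t)) (trans K′≡ (lemma (r * m) m)) ⟩
    r * m + (r * m + m) ∸ (r * m + t) ≡⟨ ℕ.[m+n]∸[m+o]≡n∸o (r * m) (r * m + m) t ⟩
    r * m + m ∸ t                   ≡⟨ reflect-∸ (r * m) m t t<m ⟩
    suc (r * m + (m ∸ suc t))       ∎
    where
    lemma : ∀ R m → R + m + R ≡ R + (R + m)
    lemma = solve-∀

  ∑-mirror-middle : ∀ (g : ℕ → ℕ) → ∑ m (λ t → g (mirror (suc (r * m + t)))) ≡ ∑ m (λ t → g (suc (r * m + t)))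
  ∑-mirror-middle g = trans (∑-cong m (λ t t<m → cong g (mirror-mid t<m))) (∑-reverse m (λ t → g (suc (r * m + t))))

  -- [1, K′] is the disjoint union of the I_a, their mirror images, and M.
  ∑-partition : ∀ (g : ℕ → ℕ) → ∑ (r * m) (λ k → g (suc k) + g (mirror (suc k))) + ∑ m (λ t → g (suc (r * m + t)))
                               ≡ ∑ K′ (λ x → g (suc x))
  ∑-partition g = begin
    ∑ R (λ k → g (suc k) + g (mirror (suc k))) + middle
      ≡⟨ cong (_+ middle) (∑-+ R (λ k → g (suc k)) (λ k → g (mirror (suc k)))) ⟩
    ∑ R (λ k → g (suc k)) + ∑ R (λ k → g (mirror (suc k))) + middle
      ≡⟨ cong (λ x → ∑ R (λ k → g (suc k)) + x + middle) mirrored-bottom ⟩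
    ∑ R (λ k → g (suc k)) + top + middle
      ≡⟨ lemma (∑ R (λ k → g (suc k))) top middle ⟩
    ∑ R (λ k → g (suc k)) + middle + top
      ≡⟨ cong (_+ top) (sym (∑-split R m (λ x → g (suc x)))) ⟩
    ∑ (R + m) (λ x → g (suc x)) + top
      ≡⟨ sym (∑-split (R + m) R (λ x → g (suc x))) ⟩
    ∑ (R + m + R) (λ x → g (suc x))
      ≡⟨ cong (λ N → ∑ N (λ x → g (suc x))) (sym K′≡) ⟩
    ∑ K′ (λ x → g (suc x)) ∎
    where
    R = r * m
    middle = ∑ m (λ t → g (suc (R + t)))
    top = ∑ R (λ k → g (suc (R + m + k)))
    mirrored-bottom : ∑ R (λ k → g (mirror (suc k))) ≡ top
    mirrored-bottom = trans (∑-cong R (λ k k<R → cong g (mirror-top k<R))) (∑-reverse R (λ k → g (suc (R + m + k))))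
    lemma : ∀ a b c → a + b + c ≡ a + c + b
    lemma = solve-∀

  keySum : (Key → ℕ) → ℕ
  keySum H = ∑ K′ (λ i → H (rungKey (suc i)))
           + ∑ (2 * n) (λ j → ∑ K′ (λ x → H (uKey (suc j) (suc x)) + H (vKey (suc j) (suc x))))

  -- key is a bijection from the edges of G onto the keys summed over by keySum.
  sum-key : ∀ H → sum (map (λ p → H (key p)) G) ≡ keySum H
  sum-key H = begin
    sum (map (λ p → H (key p)) G)
      ≡⟨ sum-edges (λ p → H (key p)) ⟩
    ∑ K′ (λ i → H (rungKey (suc i))) + (quadPart (λ p → H (key p)) + pairPart (λ p → H (key p)))
      ≡⟨ cong (∑ K′ (λ i → H (rungKey (suc i))) +_) (trans (cong₂ _+_ sum-quad-part sum-pair-part) (sym (∑-+ (2 * n) _ _))) ⟩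
    ∑ K′ (λ i → H (rungKey (suc i))) + ∑ (2 * n) (λ j → bottom j + middle j)
      ≡⟨ cong (∑ K′ (λ i → H (rungKey (suc i))) +_) (∑-cong (2 * n) (λ j _ → ∑-partition (g (suc j)))) ⟩
    keySum H ∎
    where
    R = r * m
    g : ℕ → ℕ → ℕ
    g j i = H (uKey j i) + H (vKey j i)
    bottom middle : ℕ → ℕ
    bottom j = ∑ R (λ k → g (suc j) (suc k) + g (suc j) (mirror (suc k)))
    middle j = ∑ m (λ t → g (suc j) (suc (R + t)))
    quad-sum-at : ∀ j i → H (uKey j i) + (H (vKey j (mirror i)) + (H (vKey j i) + (H (uKey j (mirror i)) + 0)))
                        ≡ g j i + g j (mirror i)
    quad-sum-at j i = lemma (H (uKey j i)) (H (vKey j (mirror i))) (H (vKey j i)) (H (uKey j (mirror i)))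
      where
      lemma : ∀ a b c d → a + (b + (c + (d + 0))) ≡ (a + c) + (d + b)
      lemma = solve-∀
    sum-quad-part : quadPart (λ p → H (key p)) ≡ ∑ (2 * n) bottom
    sum-quad-part = begin
      quadPart (λ p → H (key p))
        ≡⟨ ∑-cong r (λ a _ → ∑-cong (2 * n) (λ j _ → ∑-cong m (λ t _ → quad-sum-at (suc j) (suc (a * m + t))))) ⟩
      ∑ r (λ a → ∑ (2 * n) (λ j → ∑ m (λ t → g (suc j) (suc (a * m + t)) + g (suc j) (mirror (suc (a * m + t))))))
        ≡⟨ ∑-swap r (2 * n) _ ⟩
      ∑ (2 * n) (λ j → ∑ r (λ a → ∑ m (λ t → g (suc j) (suc (a * m + t)) + g (suc j) (mirror (suc (a * m + t))))))
        ≡⟨ ∑-cong (2 * n) (λ j _ → ∑-blocks r m (λ k → g (suc j) (suc k) + g (suc j) (mirror (suc k)))) ⟩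
      ∑ (2 * n) bottom ∎
    sum-pair-part : pairPart (λ p → H (key p)) ≡ ∑ (2 * n) middle
    sum-pair-part = ∑-cong (2 * n) (λ j _ → begin
      ∑ m (λ t → H (uKey (suc j) (suc (R + t))) + (H (vKey (suc j) (mirror (suc (R + t)))) + 0))
        ≡⟨ ∑-cong m (λ t _ → cong (H (uKey (suc j) (suc (R + t))) +_) (ℕ.+-identityʳ _)) ⟩
      ∑ m (λ t → H (uKey (suc j) (suc (R + t))) + H (vKey (suc j) (mirror (suc (R + t)))))
        ≡⟨ ∑-+ m _ _ ⟩
      ∑ m (λ t → H (uKey (suc j) (suc (R + t)))) + ∑ m (λ t → H (vKey (suc j) (mirror (suc (R + t)))))
        ≡⟨ cong (∑ m (λ t → H (uKey (suc j) (suc (R + t)))) +_) (∑-mirror-middle (λ i → H (vKey (suc j) i))) ⟩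
      ∑ m (λ t → H (uKey (suc j) (suc (R + t)))) + ∑ m (λ t → H (vKey (suc j) (suc (R + t))))
        ≡⟨ sym (∑-+ m _ _) ⟩
      middle j ∎)

  data Layer : V → Set where
    Y-layer : ∀ {a j} → 1 ≤ a → a ≤ r → InL j → Layer (Y a j)
    Z-layer : ∀ {a j} → 1 ≤ a → a ≤ r → InL j → Layer (Z a j)
    X-layer : ∀ {j} → InL j → Layer (X j)

  data Edge : V × V → Set where
    rung   : ∀ {i} → InK i → Edge (u i , v i)
    spokeᵘ : ∀ {w x} → Layer w → InK x → Edge (w , u x)
    spokeᵛ : ∀ {w y} → Layer w → InK y → Edge (w , v y)

  all-edges : All Edge G
  all-edges = Allₚ.++⁺ (Allₚ.map⁺ (All-⋯ 0 K′ K′ refl (λ k k<K′ → rung (s≤s z≤n , k<K′))))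
             (Allₚ.++⁺ (All-concatMap-⋯ _ 0 r r refl (λ a a<r →
                        All-concatMap-⋯ _ 0 (2 * n) (2 * n) refl (λ j j<2n →
                          All-concatMap-⋯ _ (a * m) m (suc a * m) (I-end a) (λ t t<m →
                            quad-edges (Y-layer (s≤s z≤n) a<r (s≤s z≤n , j<2n)) (Z-layer (s≤s z≤n) a<r (s≤s z≤n , j<2n))
                                       (quad-index a<r t<m)))))
                      (All-concatMap-⋯ _ 0 (2 * n) (2 * n) refl (λ j j<2n →
                        All-concatMap-⋯ _ (r * m) m ((r + 1) * m) M-end (λ t t<m →
                          let i∈K = pair-index t<m ; ℓ = X-layer (s≤s z≤n , j<2n) in
                          spokeᵘ ℓ i∈K ∷ spokeᵛ ℓ (mirror-InK i∈K) ∷ []))))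
    where
    quad-edges : ∀ {a j i} → Layer (Y a j) → Layer (Z a j) → InK i → All Edge (quad a j i)
    quad-edges ℓʸ ℓᶻ i∈K =
      spokeᵘ ℓʸ i∈K ∷ spokeᵛ ℓʸ (mirror-InK i∈K) ∷ spokeᵛ ℓᶻ i∈K ∷ spokeᵘ ℓᶻ (mirror-InK i∈K) ∷ []

  data Vertex : V → Set where
    u-vertex : ∀ {x} → InK x → Vertex (u x)
    v-vertex : ∀ {y} → InK y → Vertex (v y)
    layer    : ∀ {w} → Layer w → Vertex w

  all-vertices : All Vertex (Gverts n r s)
  all-vertices =
    Allₚ.++⁺ (Allₚ.map⁺ (All-⋯ 0 K′ K′ refl (λ k k<K′ → u-vertex (s≤s z≤n , k<K′))))
    (Allₚ.++⁺ (Allₚ.map⁺ (All-⋯ 0 K′ K′ refl (λ k k<K′ → v-vertex (s≤s z≤n , k<K′))))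
    (Allₚ.++⁺ (Allₚ.concat⁺ (Allₚ.map⁺ (All-⋯ 0 r r refl (λ a a<r → Allₚ.map⁺ (All-⋯ 0 (2 * n) (2 * n) refl (λ j j<2n →
                layer (Y-layer (s≤s z≤n) a<r (s≤s z≤n , j<2n))))))))
    (Allₚ.++⁺ (Allₚ.concat⁺ (Allₚ.map⁺ (All-⋯ 0 r r refl (λ a a<r → Allₚ.map⁺ (All-⋯ 0 (2 * n) (2 * n) refl (λ j j<2n →
                layer (Z-layer (s≤s z≤n) a<r (s≤s z≤n , j<2n))))))))
             (Allₚ.map⁺ (All-⋯ 0 (2 * n) (2 * n) refl (λ j j<2n → layer (X-layer (s≤s z≤n , j<2n))))))))

-- The labeling

module Labels (n r s : ℕ) where
  open Construction n r s

  -- The labels 1, …, (4n + 1)K′ form the blocks b * K′ + [1, K′], b = 0, …, 4n. Block 0 goes to the rungs,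
  -- blocks 2n and 2n + 1 to level 1 (u-edges even, v-edges odd), and blocks low j and high j to level j ≥ 2.
  low high : ℕ → ℕ
  low j  = j ∸ 1
  high j = 2 + 4 * n ∸ j

  uLabel vLabel : ℕ → ℕ → ℕ
  uLabel 1 x = 2 * n * K′ + 2 * mirror x
  uLabel j x = if isEven j then high j * K′ + x else low j * K′ + mirror x
  vLabel 1 y = 2 * n * K′ + suc (2 * (K′ ∸ y))
  vLabel j y = if isEven j then low j * K′ + y else high j * K′ + mirror y

  keyLabel : Key → ℕ
  keyLabel (rungKey i) = i
  keyLabel (uKey j x)  = uLabel j x
  keyLabel (vKey j y)  = vLabel j y

  T : ℕ
  T = (4 * n + 2) * K′ + 1

  x+mirror : ∀ {x} → InK x → x + mirror x ≡ K′ + 1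
  x+mirror (_ , x≤K′) = ℕ.m+[n∸m]≡n (ℕ.m≤n⇒m≤n+o 1 x≤K′)

  low+high : ∀ j → 1 ≤ j → j ≤ 2 + 4 * n → low j + high j ≡ 4 * n + 1
  low+high (suc j) _ (s≤s j≤) = trans (ℕ.+-comm j _) (trans (ℕ.m∸n+n≡m j≤) (ℕ.+-comm 1 (4 * n)))

  blocks-sum : ∀ a b x y → a * K′ + x + (b * K′ + y) ≡ (a + b) * K′ + (x + y)
  blocks-sum a b x y = lemma a b x y K′
    where
    lemma : ∀ a b x y K → a * K + x + (b * K + y) ≡ (a + b) * K + (x + y)
    lemma = solve-∀

  2n≤2+4n : 2 * n ≤ 2 + 4 * n
  2n≤2+4n = ℕ.≤-trans (ℕ.*-monoˡ-≤ n {2} {4} (s≤s (s≤s z≤n))) (ℕ.m≤n+m (4 * n) 2)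

  low-high-pair : ∀ {j x y} → 1 ≤ j → j ≤ 2 + 4 * n → x + y ≡ K′ + 1 → low j * K′ + x + (high j * K′ + y) ≡ T
  low-high-pair {j} {x} {y} 1≤j j≤ x+y≡ = begin
    low j * K′ + x + (high j * K′ + y)   ≡⟨ blocks-sum (low j) (high j) x y ⟩
    (low j + high j) * K′ + (x + y)     ≡⟨ cong₂ (λ b z → b * K′ + z) (low+high j 1≤j j≤) x+y≡ ⟩
    (4 * n + 1) * K′ + (K′ + 1)         ≡⟨ lemma n K′ ⟩
    T                                   ∎
    where
    lemma : ∀ n K → (4 * n + 1) * K + (K + 1) ≡ (4 * n + 2) * K + 1
    lemma = solve-∀

  pair-sum : ∀ {j x} → InL j → InK x → uLabel j x + vLabel j (mirror x) ≡ T
  pair-sum {suc zero} {x} _ x∈K = begin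
    2 * n * K′ + 2 * mirror x + (2 * n * K′ + suc (2 * (K′ ∸ mirror x)))
      ≡⟨ lemma n K′ (mirror x) (K′ ∸ mirror x) ⟩
    (4 * n) * K′ + 2 * (mirror x + (K′ ∸ mirror x)) + 1
      ≡⟨ cong (λ k → (4 * n) * K′ + 2 * k + 1) (ℕ.m+[n∸m]≡n (proj₂ (mirror-InK x∈K))) ⟩
    (4 * n) * K′ + 2 * K′ + 1
      ≡⟨ cong (_+ 1) (sym (ℕ.*-distribʳ-+ K′ (4 * n) 2)) ⟩
    T ∎
    where
    lemma : ∀ n K a b → 2 * n * K + 2 * a + (2 * n * K + suc (2 * b)) ≡ (4 * n) * K + 2 * (a + b) + 1
    lemma = solve-∀
  pair-sum {suc (suc j)} {x} (_ , j≤2n) x∈K with isEven j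
  ... | true  = trans (ℕ.+-comm (high (2 + j) * K′ + x) _)
                      (low-high-pair (s≤s z≤n) (ℕ.≤-trans j≤2n (2n≤2+4n)) (trans (ℕ.+-comm (mirror x) x) (x+mirror x∈K)))
  ... | false = low-high-pair (s≤s z≤n) (ℕ.≤-trans j≤2n (2n≤2+4n)) (x+mirror (mirror-InK x∈K))

  module VertexSums (n′ : ℕ) (n≡1+n′ : n ≡ suc n′) where

    A B C : ℕ
    A = 2 * (K′ + 1) + 6 * n * K′ + n′ * (4 * n * K′ + (K′ + 1))
    B = 3 * K′ + 2 * n * K′ + 1 + n′ * ((4 * n + 2) * K′ + (K′ + 1))
    C = m * T

    ∑-layer-pairs : ∀ (f : ℕ → ℕ) → ∑ (2 * n) (λ j → f (suc j))
                                   ≡ (f 1 + f 2) + ∑ n′ (λ t → f (suc (2 * suc t)) + f (suc (suc (2 * suc t))))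
    ∑-layer-pairs f = trans (∑-pairs n (λ j → f (suc j)))
                            (cong (λ k → ∑ k (λ t → f (suc (2 * t)) + f (suc (suc (2 * t))))) n≡1+n′)

    2*suc≤4n : ∀ {t} → t < n′ → 2 * suc t ≤ 4 * n
    2*suc≤4n {t} t<n′ = ℕ.≤-trans (ℕ.*-monoʳ-≤ 2 (ℕ.≤-trans (ℕ.m≤n⇒m≤1+n t<n′) (ℕ.≤-reflexive (sym n≡1+n′))))
                                  (ℕ.*-monoˡ-≤ n {2} {4} (s≤s (s≤s z≤n)))

    u-sum : ∀ {x} → InK x → x + ∑ (2 * n) (λ j → uLabel (suc j) x) ≡ A
    u-sum {x} x∈K = begin
      x + ∑ (2 * n) (λ j → uLabel (suc j) x)
        ≡⟨ cong (x +_) (∑-layer-pairs (λ j → uLabel j x)) ⟩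
      x + ((2 * n * K′ + 2 * mirror x + (4 * n * K′ + x)) + ∑ n′ (λ t → uLabel (suc (2 * suc t)) x + uLabel (suc (suc (2 * suc t))) x))
        ≡⟨ cong (λ z → x + ((2 * n * K′ + 2 * mirror x + (4 * n * K′ + x)) + z)) (trans (∑-cong n′ level-pair) (∑-const n′ _)) ⟩
      x + ((2 * n * K′ + 2 * mirror x + (4 * n * K′ + x)) + n′ * (4 * n * K′ + (K′ + 1)))
        ≡⟨ lemma x (mirror x) n K′ (n′ * (4 * n * K′ + (K′ + 1))) ⟩
      2 * (x + mirror x) + 6 * n * K′ + n′ * (4 * n * K′ + (K′ + 1))
        ≡⟨ cong (λ z → 2 * z + 6 * n * K′ + n′ * (4 * n * K′ + (K′ + 1))) (x+mirror x∈K) ⟩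
      A ∎
      where
      lemma : ∀ x x̄ n K c → x + ((2 * n * K + 2 * x̄ + (4 * n * K + x)) + c) ≡ 2 * (x + x̄) + 6 * n * K + c
      lemma = solve-∀
      level-pair : ∀ t → t < n′ → uLabel (suc (2 * suc t)) x + uLabel (suc (suc (2 * suc t))) x ≡ 4 * n * K′ + (K′ + 1)
      level-pair t t<n′ rewrite isEven-1+2* (suc t) | isEven-2* (suc t) = begin
        2 * suc t * K′ + mirror x + ((4 * n ∸ 2 * suc t) * K′ + x)
          ≡⟨ blocks-sum (2 * suc t) _ (mirror x) x ⟩
        (2 * suc t + (4 * n ∸ 2 * suc t)) * K′ + (mirror x + x)
          ≡⟨ cong₂ (λ b z → b * K′ + z) (ℕ.m+[n∸m]≡n (2*suc≤4n t<n′)) (trans (ℕ.+-comm (mirror x) x) (x+mirror x∈K)) ⟩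
        4 * n * K′ + (K′ + 1) ∎

    v-sum : ∀ {y} → InK y → y + ∑ (2 * n) (λ j → vLabel (suc j) y) ≡ B
    v-sum {y} y∈K = begin
      y + ∑ (2 * n) (λ j → vLabel (suc j) y)
        ≡⟨ cong (y +_) (∑-layer-pairs (λ j → vLabel j y)) ⟩
      y + ((2 * n * K′ + suc (2 * (K′ ∸ y)) + (1 * K′ + y)) + ∑ n′ (λ t → vLabel (suc (2 * suc t)) y + vLabel (suc (suc (2 * suc t))) y))
        ≡⟨ cong (λ z → y + ((2 * n * K′ + suc (2 * (K′ ∸ y)) + (1 * K′ + y)) + z)) (trans (∑-cong n′ level-pair) (∑-const n′ _)) ⟩
      y + ((2 * n * K′ + suc (2 * (K′ ∸ y)) + (1 * K′ + y)) + n′ * ((4 * n + 2) * K′ + (K′ + 1)))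
        ≡⟨ lemma y (K′ ∸ y) n K′ (n′ * ((4 * n + 2) * K′ + (K′ + 1))) ⟩
      2 * (y + (K′ ∸ y)) + K′ + 2 * n * K′ + 1 + n′ * ((4 * n + 2) * K′ + (K′ + 1))
        ≡⟨ cong (λ z → 2 * z + K′ + 2 * n * K′ + 1 + n′ * ((4 * n + 2) * K′ + (K′ + 1))) (ℕ.m+[n∸m]≡n (proj₂ y∈K)) ⟩
      2 * K′ + K′ + 2 * n * K′ + 1 + n′ * ((4 * n + 2) * K′ + (K′ + 1))
        ≡⟨ cong (λ z → z + 2 * n * K′ + 1 + n′ * ((4 * n + 2) * K′ + (K′ + 1))) (2K+K≡3K K′) ⟩
      B ∎
      where
      lemma : ∀ y w n K c → y + ((2 * n * K + suc (2 * w) + (1 * K + y)) + c) ≡ 2 * (y + w) + K + 2 * n * K + 1 + c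
      lemma = solve-∀
      2K+K≡3K : ∀ K → 2 * K + K ≡ 3 * K
      2K+K≡3K = solve-∀
      level-pair : ∀ t → t < n′ → vLabel (suc (2 * suc t)) y + vLabel (suc (suc (2 * suc t))) y ≡ (4 * n + 2) * K′ + (K′ + 1)
      level-pair t t<n′ rewrite isEven-1+2* (suc t) | isEven-2* (suc t) = begin
        (suc (4 * n) ∸ 2 * suc t) * K′ + mirror y + (suc (2 * suc t) * K′ + y)
          ≡⟨ blocks-sum (suc (4 * n) ∸ 2 * suc t) _ (mirror y) y ⟩
        ((suc (4 * n) ∸ 2 * suc t) + suc (2 * suc t)) * K′ + (mirror y + y)
          ≡⟨ cong₂ (λ b z → b * K′ + z) blocks (trans (ℕ.+-comm (mirror y) y) (x+mirror y∈K)) ⟩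
        (4 * n + 2) * K′ + (K′ + 1) ∎
        where
        blocks : (suc (4 * n) ∸ 2 * suc t) + suc (2 * suc t) ≡ 4 * n + 2
        blocks = trans (ℕ.+-suc _ (2 * suc t))
                       (trans (cong suc (ℕ.m∸n+n≡m (ℕ.m≤n⇒m≤1+n (2*suc≤4n t<n′)))) (ℕ.+-comm 2 (4 * n)))

    -- K′ = 2κ + 1; κ is the paper's k
    κ : ℕ
    κ = 2 * r * s + r + s

    A-even : A ≡ 2 * (K′ + 1 + 3 * n * K′ + n′ * (2 * n * K′ + suc κ))
    A-even = lemma n n′ r s
      where
      lemma : ∀ n n′ r s → let K = (2 * r + 1) * (2 * s + 1) ; κ = 2 * r * s + r + s in
              2 * (K + 1) + 6 * n * K + n′ * (4 * n * K + (K + 1)) ≡ 2 * (K + 1 + 3 * n * K + n′ * (2 * n * K + suc κ))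
      lemma = solve-∀

    B-even : B ≡ 2 * (3 * κ + 2 + n * K′ + n′ * ((2 * n + 1) * K′ + suc κ))
    B-even = lemma n n′ r s
      where
      lemma : ∀ n n′ r s → let K = (2 * r + 1) * (2 * s + 1) ; κ = 2 * r * s + r + s in
              3 * K + 2 * n * K + 1 + n′ * ((4 * n + 2) * K + (K + 1))
              ≡ 2 * (3 * κ + 2 + n * K + n′ * ((2 * n + 1) * K + suc κ))
      lemma = solve-∀

    C-odd : C ≡ suc (2 * (s * T + (2 * n + 1) * K′))
    C-odd = lemma s n K′
      where
      lemma : ∀ s n K → (2 * s + 1) * ((4 * n + 2) * K + 1) ≡ suc (2 * (s * ((4 * n + 2) * K + 1) + (2 * n + 1) * K))
      lemma = solve-∀

    A≡B+ : A ≡ B + suc (K′ + 2 * n * K′)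
    A≡B+ = subst (λ N → 2 * (K′ + 1) + 6 * N * K′ + n′ * (4 * N * K′ + (K′ + 1))
                       ≡ 3 * K′ + 2 * N * K′ + 1 + n′ * ((4 * N + 2) * K′ + (K′ + 1)) + suc (K′ + 2 * N * K′))
                 (sym n≡1+n′) (lemma n′ K′)
      where
      lemma : ∀ n′ K → 2 * (K + 1) + 6 * suc n′ * K + n′ * (4 * suc n′ * K + (K + 1))
                       ≡ 3 * K + 2 * suc n′ * K + 1 + n′ * ((4 * suc n′ + 2) * K + (K + 1)) + suc (K + 2 * suc n′ * K)
      lemma = solve-∀

    A≢B : A ≢ B
    A≢B A≡B = ℕ.m≢1+n+m B {K′ + 2 * n * K′} (sym (trans (ℕ.+-comm (suc (K′ + 2 * n * K′)) B) (trans (sym A≡B+) A≡B)))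

    A≢C : A ≢ C
    A≢C A≡C = ℕ.even≢odd (K′ + 1 + 3 * n * K′ + n′ * (2 * n * K′ + suc κ)) (s * T + (2 * n + 1) * K′)
                         (trans (sym A-even) (trans A≡C C-odd))

    B≢C : B ≢ C
    B≢C B≡C = ℕ.even≢odd (3 * κ + 2 + n * K′ + n′ * ((2 * n + 1) * K′ + suc κ)) (s * T + (2 * n + 1) * K′)
                         (trans (sym B-even) (trans B≡C C-odd))

-- The labels are distinct and lie in [1, (4n + 1)K]

module Injectivity (n r s : ℕ) where
  open Construction n r s
  open Labels n r s

  InKey : Key → Set
  InKey (rungKey i) = InK i
  InKey (uKey j x)  = InL j × InK x
  InKey (vKey j y)  = InL j × InK y

  lowKey highKey : ℕ → ℕ → Key
  lowKey j o  = if isEven j then vKey j o else uKey j (mirror o)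
  highKey j o = if isEven j then uKey j o else vKey j (mirror o)

  -- the key outside level 1 whose label is b * K′ + o
  decode : ℕ → ℕ → Key
  decode b o = if does (b <? 1) then rungKey o
               else if does (b <? 2 * n) then lowKey (suc b) o
               else highKey (high b) o

  record Blocked (k : Key) : Set where
    field
      block offset : ℕ
      offset∈K  : InK offset
      block-gap : block < 2 * n ⊎ 2 + 2 * n ≤ block
      block≤4n  : block ≤ 4 * n
      label≡    : keyLabel k ≡ block * K′ + offset
      decode≡   : decode block offset ≡ k

  low-blocked : ∀ {j o} k → 2 ≤ j → j ≤ 2 * n → InK o → keyLabel k ≡ low j * K′ + o → lowKey j o ≡ k → Blocked k
  low-blocked {suc (suc j)} {o} k (s≤s (s≤s _)) j≤2n o∈K label≡ key≡ = record
    { block = suc j ; offset = o ; offset∈K = o∈K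
    ; block-gap = inj₁ j≤2n
    ; block≤4n = ℕ.≤-trans (ℕ.n≤1+n _) (ℕ.≤-trans j≤2n (ℕ.*-monoˡ-≤ n {2} {4} (s≤s (s≤s z≤n))))
    ; label≡ = label≡
    ; decode≡ = trans decode-low key≡ }
    where
    decode-low : decode (suc j) o ≡ lowKey (suc (suc j)) o
    decode-low rewrite dec-false (suc j <? 1) (λ { (s≤s ()) }) | dec-true (suc j <? 2 * n) j≤2n = refl

  high-blocked : ∀ {j o} k → 2 ≤ j → j ≤ 2 * n → InK o → keyLabel k ≡ high j * K′ + o → highKey j o ≡ k → Blocked k
  high-blocked {j} {o} k 2≤j j≤2n o∈K label≡ key≡ = record
    { block = high j ; offset = o ; offset∈K = o∈K
    ; block-gap = inj₂ gap
    ; block≤4n = ℕ.∸-monoʳ-≤ (2 + 4 * n) 2≤j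
    ; label≡ = label≡
    ; decode≡ = trans decode-high (trans (cong (λ i → highKey i o) (ℕ.m∸[m∸n]≡n (ℕ.≤-trans j≤2n 2n≤2+4n))) key≡) }
    where
    gap : 2 + 2 * n ≤ high j
    gap = ℕ.≤-trans (ℕ.≤-reflexive (sym (trans (cong (_∸ 2 * n) (lemma n)) (ℕ.m+n∸n≡m (2 + 2 * n) (2 * n)))))
                    (ℕ.∸-monoʳ-≤ (2 + 4 * n) j≤2n)
      where
      lemma : ∀ n → 2 + 4 * n ≡ 2 + 2 * n + 2 * n
      lemma = solve-∀
    decode-high : decode (high j) o ≡ highKey (high (high j)) o
    decode-high rewrite dec-false (high j <? 1) (ℕ.≤⇒≯ (ℕ.≤-trans (s≤s z≤n) gap))
                      | dec-false (high j <? 2 * n) (ℕ.≤⇒≯ (ℕ.≤-trans (ℕ.m≤n+m (2 * n) 2) gap)) = refl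

  data KeyView : Key → Set where
    level-1ᵘ : ∀ {x} → InK x → KeyView (uKey 1 x)
    level-1ᵛ : ∀ {y} → InK y → KeyView (vKey 1 y)
    blocked  : ∀ {k} → Blocked k → KeyView k

  module _ (0<n : 0 < n) where

    view : ∀ {k} → InKey k → KeyView k
    view {rungKey i} i∈K = blocked (record
      { block = 0 ; offset = i ; offset∈K = i∈K ; block-gap = inj₁ (ℕ.≤-trans 0<n (ℕ.m≤n*m n 2)) ; block≤4n = z≤n
      ; label≡ = refl ; decode≡ = refl })
    view {uKey zero x}          ((() , _) , _)
    view {uKey (suc zero) x}    (_ , x∈K) = level-1ᵘ x∈K
    view {uKey (suc (suc j)) x} ((_ , j≤2n) , x∈K) with isEven j in even?
    ... | true  = blocked (high-blocked (uKey (2 + j) x) (s≤s (s≤s z≤n)) j≤2n x∈K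
                            (cong (λ b → if b then high (2 + j) * K′ + x else low (2 + j) * K′ + mirror x) even?)
                            (cong (λ b → if b then uKey (2 + j) x else vKey (2 + j) (mirror x)) even?))
    ... | false = blocked (low-blocked (uKey (2 + j) x) (s≤s (s≤s z≤n)) j≤2n (mirror-InK x∈K)
                            (cong (λ b → if b then high (2 + j) * K′ + x else low (2 + j) * K′ + mirror x) even?)
                            (trans (cong (λ b → if b then vKey (2 + j) (mirror x) else uKey (2 + j) (mirror (mirror x))) even?)
                                   (cong (uKey (2 + j)) (mirror-involutive x∈K))))
    view {vKey zero y}          ((() , _) , _)
    view {vKey (suc zero) y}    (_ , y∈K) = level-1ᵛ y∈K
    view {vKey (suc (suc j)) y} ((_ , j≤2n) , y∈K) with isEven j in even?
    ... | true  = blocked (low-blocked (vKey (2 + j) y) (s≤s (s≤s z≤n)) j≤2n y∈K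
                            (cong (λ b → if b then low (2 + j) * K′ + y else high (2 + j) * K′ + mirror y) even?)
                            (cong (λ b → if b then vKey (2 + j) y else uKey (2 + j) (mirror y)) even?))
    ... | false = blocked (high-blocked (vKey (2 + j) y) (s≤s (s≤s z≤n)) j≤2n (mirror-InK y∈K)
                            (cong (λ b → if b then low (2 + j) * K′ + y else high (2 + j) * K′ + mirror y) even?)
                            (trans (cong (λ b → if b then uKey (2 + j) (mirror y) else vKey (2 + j) (mirror (mirror y))) even?)
                                   (cong (vKey (2 + j)) (mirror-involutive y∈K))))

    level-1-bounds : ∀ {w} → 1 ≤ w × w ≤ 2 * K′ → 1 ≤ 2 * n * K′ + w × 2 * n * K′ + w ≤ (4 * n + 1) * K′
    level-1-bounds (1≤w , w≤2K′) = ℕ.≤-trans 1≤w (ℕ.m≤n+m _ _)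
                                 , ℕ.≤-trans (ℕ.+-monoʳ-≤ (2 * n * K′) w≤2K′) level-1≤last-block
      where
      2n+2≤4n+1 : ∀ n → 0 < n → 2 * n + 2 ≤ 4 * n + 1
      2n+2≤4n+1 (suc n) _ = ℕ.≤-trans (ℕ.m≤m+n (2 * suc n + 2) (2 * n + 1)) (ℕ.≤-reflexive (lemma n))
        where
        lemma : ∀ n → 2 * suc n + 2 + (2 * n + 1) ≡ 4 * suc n + 1
        lemma = solve-∀
      level-1≤last-block : 2 * n * K′ + 2 * K′ ≤ (4 * n + 1) * K′
      level-1≤last-block = ℕ.≤-trans (ℕ.≤-reflexive (sym (ℕ.*-distribʳ-+ K′ (2 * n) 2))) (ℕ.*-monoˡ-≤ K′ (2n+2≤4n+1 n 0<n))

    level-1ᵘ-offset : ∀ {x} → InK x → 1 ≤ 2 * mirror x × 2 * mirror x ≤ 2 * K′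
    level-1ᵘ-offset x∈K = let (1≤x̄ , x̄≤K′) = mirror-InK x∈K in
                          ℕ.≤-trans 1≤x̄ (ℕ.m≤n*m _ 2) , ℕ.*-monoʳ-≤ 2 x̄≤K′

    level-1ᵛ-offset : ∀ {y} → InK y → 1 ≤ suc (2 * (K′ ∸ y)) × suc (2 * (K′ ∸ y)) ≤ 2 * K′
    level-1ᵛ-offset {suc y} (_ , y<K′) =
      s≤s z≤n , ℕ.≤-trans (ℕ.n≤1+n _) (ℕ.≤-trans (ℕ.≤-reflexive (lemma (K′ ∸ suc y)))
                                                  (ℕ.*-monoʳ-≤ 2 (subst (_≤ K′) (ℕ.+-∸-assoc 1 y<K′) (ℕ.m∸n≤m K′ y))))
      where
      lemma : ∀ w → suc (suc (2 * w)) ≡ 2 * suc w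
      lemma = solve-∀

    blocked-avoids-level-1 : ∀ {k w} → Blocked k → 1 ≤ w × w ≤ 2 * K′ → keyLabel k ≢ 2 * n * K′ + w
    blocked-avoids-level-1 {k} {w} β (1≤w , w≤2K′) eq with block-gap | trans (sym label≡) eq
      where open Blocked β
    ... | inj₁ b<2n | bK′+o≡ = ℕ.<⇒≢ (ℕ.≤-<-trans (ℕ.≤-trans (ℕ.+-monoʳ-≤ (block * K′) (proj₂ offset∈K))
                                                         (ℕ.≤-trans (ℕ.≤-reflexive (ℕ.+-comm (block * K′) K′)) (ℕ.*-monoˡ-≤ K′ b<2n)))
                                              (ℕ.m<m+n (2 * n * K′) 1≤w)) bK′+o≡
      where open Blocked β
    ... | inj₂ 2+2n≤b | bK′+o≡ = ℕ.<⇒≢ (ℕ.≤-<-trans (ℕ.≤-trans (ℕ.+-monoʳ-≤ (2 * n * K′) w≤2K′)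
                                                           (ℕ.≤-trans (ℕ.≤-reflexive (lemma n K′)) (ℕ.*-monoˡ-≤ K′ 2+2n≤b)))
                                                (ℕ.m<m+n (block * K′) (proj₁ offset∈K))) (sym bK′+o≡)
      where
      open Blocked β
      lemma : ∀ n K → 2 * n * K + 2 * K ≡ (2 + 2 * n) * K
      lemma = solve-∀

    keyLabel-injective : ∀ {k k′} → InKey k → InKey k′ → keyLabel k ≡ keyLabel k′ → k ≡ k′
    keyLabel-injective k∈ k′∈ eq with view k∈ | view k′∈
    ... | level-1ᵘ {x} x∈K | level-1ᵘ {x′} x′∈K =
      cong (uKey 1) (mirror-injective x∈K x′∈K
                      (ℕ.*-cancelˡ-≡ (mirror x) (mirror x′) 2 (ℕ.+-cancelˡ-≡ (2 * n * K′) _ _ eq)))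
    ... | level-1ᵘ {x} _ | level-1ᵛ {y} _ = ⊥-elim (ℕ.even≢odd (mirror x) (K′ ∸ y) (ℕ.+-cancelˡ-≡ (2 * n * K′) _ _ eq))
    ... | level-1ᵛ {y} _ | level-1ᵘ {x} _ = ⊥-elim (ℕ.even≢odd (mirror x) (K′ ∸ y) (ℕ.+-cancelˡ-≡ (2 * n * K′) _ _ (sym eq)))
    ... | level-1ᵛ {y} (_ , y≤K′) | level-1ᵛ {y′} (_ , y′≤K′) =
      cong (vKey 1) (trans (sym (ℕ.m∸[m∸n]≡n y≤K′))
                           (trans (cong (K′ ∸_) (ℕ.*-cancelˡ-≡ (K′ ∸ y) (K′ ∸ y′) 2
                                                   (ℕ.suc-injective (ℕ.+-cancelˡ-≡ (2 * n * K′) _ _ eq))))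
                                  (ℕ.m∸[m∸n]≡n y′≤K′)))
    ... | level-1ᵘ x∈K | blocked β = ⊥-elim (blocked-avoids-level-1 β (level-1ᵘ-offset x∈K) (sym eq))
    ... | level-1ᵛ y∈K | blocked β = ⊥-elim (blocked-avoids-level-1 β (level-1ᵛ-offset y∈K) (sym eq))
    ... | blocked β | level-1ᵘ x∈K = ⊥-elim (blocked-avoids-level-1 β (level-1ᵘ-offset x∈K) eq)
    ... | blocked β | level-1ᵛ y∈K = ⊥-elim (blocked-avoids-level-1 β (level-1ᵛ-offset y∈K) eq)
    ... | blocked β | blocked β′
      with same-block , same-offset ← block-offset-unique K′ {Blocked.block β} {Blocked.block β′}
                                        (Blocked.offset∈K β) (Blocked.offset∈K β′)
                                        (trans (sym (Blocked.label≡ β)) (trans eq (Blocked.label≡ β′)))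
      = trans (sym (Blocked.decode≡ β)) (trans (cong₂ decode same-block same-offset) (Blocked.decode≡ β′))

    keyLabel-bounds : ∀ {k} → InKey k → 1 ≤ keyLabel k × keyLabel k ≤ (4 * n + 1) * K′
    keyLabel-bounds k∈ with view k∈
    ... | level-1ᵘ x∈K = level-1-bounds (level-1ᵘ-offset x∈K)
    ... | level-1ᵛ y∈K = level-1-bounds (level-1ᵛ-offset y∈K)
    ... | blocked β = subst (λ ℓ → 1 ≤ ℓ × ℓ ≤ (4 * n + 1) * K′) (sym label≡)
                            ( ℕ.≤-trans (proj₁ offset∈K) (ℕ.m≤n+m offset (block * K′))
                            , ℕ.≤-trans (ℕ.+-mono-≤ (ℕ.*-monoˡ-≤ K′ block≤4n) (proj₂ offset∈K))
                                        (ℕ.≤-reflexive (lemma n K′)))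
      where
      open Blocked β
      lemma : ∀ n K → 4 * n * K + K ≡ (4 * n + 1) * K
      lemma = solve-∀

-- Vertex sums and colour number of the labeling

module Theorem (n r s n′ : ℕ) (n≡1+n′ : n ≡ suc n′) where
  open Construction n r s
  open Labels n r s
  open VertexSums n′ n≡1+n′
  open Injectivity n r s

  Γ : Graph
  Γ = G2n n r s

  incident : V → V × V → Bool
  incident = Graph.incident Γ

  labelOf : V × V → ℕ
  labelOf p = keyLabel (key p)

  term : V → V × V → ℕ
  term w p = if incident w p then labelOf p else 0

  vertexSum : V → ℕ
  vertexSum w = sum (map (term w) G)

  touches : V → Key → Bool
  touches w (rungKey i) = does (w ≟ u i) ∨ does (w ≟ v i)
  touches w (uKey _ x)  = does (w ≟ u x)
  touches w (vKey _ y)  = does (w ≟ v y)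

  weight : V → Key → ℕ
  weight w k = if touches w k then keyLabel k else 0

  -- On each edge shape listed by sum-edges, term (u x) and term (v y) agree definitionally with weight ∘ key.
  vertexSum-u≡keySum : ∀ x → vertexSum (u x) ≡ keySum (weight (u x))
  vertexSum-u≡keySum x = trans (sum-edges (term (u x))) (trans (sym (sum-edges (λ p → weight (u x) (key p)))) (sum-key (weight (u x))))

  vertexSum-v≡keySum : ∀ y → vertexSum (v y) ≡ keySum (weight (v y))
  vertexSum-v≡keySum y = trans (sum-edges (term (v y))) (trans (sym (sum-edges (λ p → weight (v y) (key p)))) (sum-key (weight (v y))))

  vertexSum-u : ∀ {x} → InK x → vertexSum (u x) ≡ A
  vertexSum-u {x} x∈K = begin
    vertexSum (u x)
      ≡⟨ vertexSum-u≡keySum x ⟩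
    keySum (weight (u x))
      ≡⟨ cong₂ _+_ (∑-cong K′ (λ i _ → trans (cong (λ b → if b then suc i else 0) (∨-identityʳ _)) (u-indicator (suc i))))
                   (∑-cong (2 * n) (λ j _ → ∑-cong K′ (λ i _ → trans (ℕ.+-identityʳ _) (u-indicator (suc i))))) ⟩
    ∑ K′ (λ i → δ x (suc i) * suc i) + ∑ (2 * n) (λ j → ∑ K′ (λ i → δ x (suc i) * uLabel (suc j) (suc i)))
      ≡⟨ cong₂ _+_ (∑-select K′ (λ i → i) (proj₁ x∈K) (proj₂ x∈K))
                   (∑-cong (2 * n) (λ j _ → ∑-select K′ (uLabel (suc j)) (proj₁ x∈K) (proj₂ x∈K))) ⟩
    x + ∑ (2 * n) (λ j → uLabel (suc j) x)
      ≡⟨ u-sum x∈K ⟩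
    A ∎
    where
    u-indicator : ∀ i {c} → (if does (u x ≟ u i) then c else 0) ≡ δ x i * c
    u-indicator i = if-δ (u x ≟ u i) (λ { refl → refl }) (cong u) _

  vertexSum-v : ∀ {y} → InK y → vertexSum (v y) ≡ B
  vertexSum-v {y} y∈K = begin
    vertexSum (v y)
      ≡⟨ vertexSum-v≡keySum y ⟩
    keySum (weight (v y))
      ≡⟨ cong₂ _+_ (∑-cong K′ (λ i _ → v-indicator (suc i)))
                   (∑-cong (2 * n) (λ j _ → ∑-cong K′ (λ i _ → v-indicator (suc i)))) ⟩
    ∑ K′ (λ i → δ y (suc i) * suc i) + ∑ (2 * n) (λ j → ∑ K′ (λ i → δ y (suc i) * vLabel (suc j) (suc i)))
      ≡⟨ cong₂ _+_ (∑-select K′ (λ i → i) (proj₁ y∈K) (proj₂ y∈K))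
                   (∑-cong (2 * n) (λ j _ → ∑-select K′ (vLabel (suc j)) (proj₁ y∈K) (proj₂ y∈K))) ⟩
    y + ∑ (2 * n) (λ j → vLabel (suc j) y)
      ≡⟨ v-sum y∈K ⟩
    B ∎
    where
    v-indicator : ∀ i {c} → (if does (v y ≟ v i) then c else 0) ≡ δ y i * c
    v-indicator i = if-δ (v y ≟ v i) (λ { refl → refl }) (cong v) _

  sum-edges-layers : ∀ (F : V × V → ℕ) (Q : ℕ → ℕ → ℕ) (P : ℕ → ℕ) →
    (∀ k → F (u k , v k) ≡ 0) →
    (∀ {a j i} → a < r → j < 2 * n → InK i → quadSum F (suc a) (suc j) i ≡ Q a j) →
    (∀ {j i} → j < 2 * n → InK i → pairSum F (suc j) i ≡ P j) →
    sum (map F G) ≡ m * (∑ r (λ a → ∑ (2 * n) (Q a)) + ∑ (2 * n) P)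
  sum-edges-layers F Q P rung≡0 quad≡ pair≡ = begin
    sum (map F G)
      ≡⟨ sum-edges F ⟩
    rungPart F + (quadPart F + pairPart F)
      ≡⟨ cong₂ _+_ (trans (∑-cong K′ (λ k _ → rung≡0 (suc k))) (∑-zero K′))
                   (cong₂ _+_ (∑-cong r (λ a a<r → ∑-cong (2 * n) (λ j j<2n → trans (∑-cong m (λ t t<m → quad≡ a<r j<2n (quad-index a<r t<m)))
                                                                                      (∑-const m (Q a j)))))
                              (∑-cong (2 * n) (λ j j<2n → trans (∑-cong m (λ t t<m → pair≡ j<2n (pair-index t<m))) (∑-const m (P j))))) ⟩
    ∑ r (λ a → ∑ (2 * n) (λ j → m * Q a j)) + ∑ (2 * n) (λ j → m * P j)
      ≡⟨ cong₂ _+_ (trans (∑-cong r (λ a _ → ∑-*ˡ (2 * n) m (Q a))) (∑-*ˡ r m _)) (∑-*ˡ (2 * n) m P) ⟩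
    m * ∑ r (λ a → ∑ (2 * n) (Q a)) + m * ∑ (2 * n) P
      ≡⟨ sym (ℕ.*-distribˡ-+ m _ _) ⟩
    m * (∑ r (λ a → ∑ (2 * n) (Q a)) + ∑ (2 * n) P) ∎

  both-or-neither : ∀ d a b → (if d ∨ false then a else 0) + ((if d ∨ false then b else 0) + 0) ≡ (if d then a + b else 0)
  both-or-neither true  a b = cong (a +_) (ℕ.+-identityʳ b)
  both-or-neither false a b = refl

  vertexSum-by-quads : ∀ w {a₀ j₀} → 1 ≤ a₀ → a₀ ≤ r → InL j₀ →
    (∀ k → term w (u k , v k) ≡ 0) →
    (∀ {a j i} → a < r → j < 2 * n → InK i → quadSum (term w) (suc a) (suc j) i ≡ δ a₀ (suc a) * (δ j₀ (suc j) * T)) →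
    (∀ {j i} → j < 2 * n → InK i → pairSum (term w) (suc j) i ≡ 0) →
    vertexSum w ≡ C
  vertexSum-by-quads w {a₀} {j₀} 1≤a₀ a₀≤r j₀∈L rung≡0 quad≡ pair≡0 = begin
    vertexSum w
      ≡⟨ sum-edges-layers (term w) (λ a j → δ a₀ (suc a) * (δ j₀ (suc j) * T)) (λ _ → 0) rung≡0 quad≡ pair≡0 ⟩
    m * (∑ r (λ a → ∑ (2 * n) (λ j → δ a₀ (suc a) * (δ j₀ (suc j) * T))) + ∑ (2 * n) (λ _ → 0))
      ≡⟨ cong (m *_) (cong₂ _+_ (∑-select₂ r (2 * n) T 1≤a₀ a₀≤r (proj₁ j₀∈L) (proj₂ j₀∈L)) (∑-zero (2 * n))) ⟩
    m * (T + 0)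
      ≡⟨ cong (m *_) (ℕ.+-identityʳ T) ⟩
    C ∎

  vertexSum-Y : ∀ {a₀ j₀} → 1 ≤ a₀ → a₀ ≤ r → InL j₀ → vertexSum (Y a₀ j₀) ≡ C
  vertexSum-Y {a₀} {j₀} 1≤a₀ a₀≤r j₀∈L =
    vertexSum-by-quads (Y a₀ j₀) 1≤a₀ a₀≤r j₀∈L (λ _ → refl) quad≡ (λ _ _ → refl)
    where
    quad≡ : ∀ {a j i} → a < r → j < 2 * n → InK i →
            quadSum (term (Y a₀ j₀)) (suc a) (suc j) i ≡ δ a₀ (suc a) * (δ j₀ (suc j) * T)
    quad≡ {a} {j} {i} _ j<2n i∈K =
      trans (both-or-neither (does (Y a₀ j₀ ≟ Y (suc a) (suc j))) _ _)
            (trans (if-δ₂ (Y a₀ j₀ ≟ Y (suc a) (suc j)) {a₀} {suc a} {j₀} {suc j}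
                          (λ { refl → refl , refl }) (λ { refl refl → refl }) _)
                   (cong (λ c → δ a₀ (suc a) * (δ j₀ (suc j) * c)) (pair-sum (s≤s z≤n , j<2n) i∈K)))

  vertexSum-Z : ∀ {a₀ j₀} → 1 ≤ a₀ → a₀ ≤ r → InL j₀ → vertexSum (Z a₀ j₀) ≡ C
  vertexSum-Z {a₀} {j₀} 1≤a₀ a₀≤r j₀∈L =
    vertexSum-by-quads (Z a₀ j₀) 1≤a₀ a₀≤r j₀∈L (λ _ → refl) quad≡ (λ _ _ → refl)
    where
    quad≡ : ∀ {a j i} → a < r → j < 2 * n → InK i →
            quadSum (term (Z a₀ j₀)) (suc a) (suc j) i ≡ δ a₀ (suc a) * (δ j₀ (suc j) * T)
    quad≡ {a} {j} {i} _ j<2n i∈K =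
      trans (both-or-neither (does (Z a₀ j₀ ≟ Z (suc a) (suc j))) _ _)
            (trans (if-δ₂ (Z a₀ j₀ ≟ Z (suc a) (suc j)) {a₀} {suc a} {j₀} {suc j}
                          (λ { refl → refl , refl }) (λ { refl refl → refl }) _)
                   (cong (λ c → δ a₀ (suc a) * (δ j₀ (suc j) * c)) mirrored-pair))
      where
      mirrored-pair : vLabel (suc j) i + uLabel (suc j) (mirror i) ≡ T
      mirrored-pair = trans (ℕ.+-comm (vLabel (suc j) i) _)
                            (trans (cong (λ y → uLabel (suc j) (mirror i) + vLabel (suc j) y) (sym (mirror-involutive i∈K)))
                                   (pair-sum (s≤s z≤n , j<2n) (mirror-InK i∈K)))

  vertexSum-X : ∀ {j₀} → InL j₀ → vertexSum (X j₀) ≡ C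
  vertexSum-X {j₀} j₀∈L = begin
    vertexSum (X j₀)
      ≡⟨ sum-edges-layers _ (λ _ _ → 0) (λ j → δ j₀ (suc j) * T) (λ _ → refl) (λ _ _ _ → refl) pair≡ ⟩
    m * (∑ r (λ _ → ∑ (2 * n) (λ _ → 0)) + ∑ (2 * n) (λ j → δ j₀ (suc j) * T))
      ≡⟨ cong (m *_) (cong₂ _+_ (trans (∑-cong r (λ _ _ → ∑-zero (2 * n))) (∑-zero r))
                                (∑-select (2 * n) (λ _ → T) (proj₁ j₀∈L) (proj₂ j₀∈L))) ⟩
    C ∎
    where
    pair≡ : ∀ {j i} → j < 2 * n → InK i → pairSum (term (X j₀)) (suc j) i ≡ δ j₀ (suc j) * T
    pair≡ {j} {i} j<2n i∈K =
      trans (both-or-neither (does (X j₀ ≟ X (suc j))) _ _)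
            (trans (if-δ (X j₀ ≟ X (suc j)) (λ { refl → refl }) (cong X) _)
                   (cong (δ j₀ (suc j) *_) (pair-sum (s≤s z≤n , j<2n) i∈K)))

  vertexSum-layer : ∀ {w} → Layer w → vertexSum w ≡ C
  vertexSum-layer (Y-layer 1≤a a≤r j∈L) = vertexSum-Y 1≤a a≤r j∈L
  vertexSum-layer (Z-layer 1≤a a≤r j∈L) = vertexSum-Z 1≤a a≤r j∈L
  vertexSum-layer (X-layer j∈L)         = vertexSum-X j∈L

  edge-key : ∀ {p} → Edge p → InKey (key p)
  edge-key (rung i∈K) = i∈K
  edge-key (spokeᵘ (Y-layer _ _ j∈L) x∈K) = j∈L , x∈K
  edge-key (spokeᵘ (Z-layer _ _ j∈L) x∈K) = j∈L , x∈K
  edge-key (spokeᵘ (X-layer j∈L) x∈K)     = j∈L , x∈K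
  edge-key (spokeᵛ (Y-layer _ _ j∈L) y∈K) = j∈L , y∈K
  edge-key (spokeᵛ (Z-layer _ _ j∈L) y∈K) = j∈L , y∈K
  edge-key (spokeᵛ (X-layer j∈L) y∈K)     = j∈L , y∈K

  endpoint-sums-differ : ∀ {p} → Edge p → vertexSum (proj₁ p) ≢ vertexSum (proj₂ p)
  endpoint-sums-differ (rung i∈K) eq = A≢B (trans (sym (vertexSum-u i∈K)) (trans eq (vertexSum-v i∈K)))
  endpoint-sums-differ (spokeᵘ ℓ x∈K) eq = A≢C (trans (sym (vertexSum-u x∈K)) (trans (sym eq) (vertexSum-layer ℓ)))
  endpoint-sums-differ (spokeᵛ ℓ y∈K) eq = B≢C (trans (sym (vertexSum-v y∈K)) (trans (sym eq) (vertexSum-layer ℓ)))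

  δKey : Key → Key → ℕ
  δKey (rungKey i) (rungKey i′) = δ i i′
  δKey (uKey j x)  (uKey j′ x′) = δ j j′ * δ x x′
  δKey (vKey j y)  (vKey j′ y′) = δ j j′ * δ y y′
  δKey _           _            = 0

  δKey-refl : ∀ k → δKey k k ≡ 1
  δKey-refl (rungKey i) = δ-refl i
  δKey-refl (uKey j x)  = cong₂ _*_ (δ-refl j) (δ-refl x)
  δKey-refl (vKey j y)  = cong₂ _*_ (δ-refl j) (δ-refl y)

  keySum-δKey : ∀ {k} → InKey k → keySum (δKey k) ≡ 1
  keySum-δKey {rungKey i} (1≤i , i≤K′) =
    cong₂ _+_ (∑-δ-in K′ 1 i 1≤i (s≤s i≤K′)) (trans (∑-cong (2 * n) (λ _ _ → ∑-zero K′)) (∑-zero (2 * n)))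
  keySum-δKey {uKey j x} (j∈L , x∈K) =
    cong₂ _+_ (∑-zero K′) (trans (∑-cong (2 * n) (λ j′ _ → ∑-cong K′ (λ x′ _ →
                                   trans (ℕ.+-identityʳ _) (cong (δ j (suc j′) *_) (sym (ℕ.*-identityʳ _))))))
                                 (∑-select₂ (2 * n) K′ 1 (proj₁ j∈L) (proj₂ j∈L) (proj₁ x∈K) (proj₂ x∈K)))
  keySum-δKey {vKey j y} (j∈L , y∈K) =
    cong₂ _+_ (∑-zero K′) (trans (∑-cong (2 * n) (λ j′ _ → ∑-cong K′ (λ y′ _ → cong (δ j (suc j′) *_) (sym (ℕ.*-identityʳ _)))))
                                 (∑-select₂ (2 * n) K′ 1 (proj₁ j∈L) (proj₂ j∈L) (proj₁ y∈K) (proj₂ y∈K)))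

  keys-distinct : AllPairs (λ p p′ → key p ≢ key p′) G
  keys-distinct = count≤1⇒distinct key δKey δKey-refl G λ {p} p∈G →
    ℕ.≤-reflexive (trans (sum-key (δKey (key p))) (keySum-δKey (edge-key (All.lookup all-edges p∈G))))

  number-of-edges : length G ≡ (4 * n + 1) * K′
  number-of-edges = begin
    length G                                           ≡⟨ length≡sum G ⟩
    sum (map (λ _ → 1) G)                              ≡⟨ sum-key (λ _ → 1) ⟩
    ∑ K′ (λ _ → 1) + ∑ (2 * n) (λ _ → ∑ K′ (λ _ → 2))
      ≡⟨ cong₂ _+_ (∑-const K′ 1) (trans (∑-cong (2 * n) (λ _ _ → ∑-const K′ 2)) (∑-const (2 * n) _)) ⟩
    K′ * 1 + 2 * n * (K′ * 2)                          ≡⟨ lemma n K′ ⟩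
    (4 * n + 1) * K′                                   ∎
    where
    lemma : ∀ n K → K * 1 + 2 * n * (K * 2) ≡ (4 * n + 1) * K
    lemma = solve-∀

  0<n : 0 < n
  0<n = subst (0 <_) (sym n≡1+n′) z<s

  edge-at : ∀ (e : Fin (length G)) → Edge (lookup G e)
  edge-at e = All.lookup all-edges (∈-lookup e)

  label-range : ∀ e → 1 ≤ labelOf (lookup G e) × labelOf (lookup G e) ≤ length G
  label-range e with keyLabel-bounds 0<n (edge-key (edge-at e))
  ... | 1≤ℓ , ℓ≤q = 1≤ℓ , subst (labelOf (lookup G e) ≤_) (sym number-of-edges) ℓ≤q

  π : Fin (length G) → Fin (length G)
  π e = fromLabel (proj₁ (label-range e)) (proj₂ (label-range e))

  π-label : ∀ e → suc (toℕ (π e)) ≡ labelOf (lookup G e)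
  π-label e = suc-toℕ-fromLabel (proj₁ (label-range e)) (proj₂ (label-range e))

  π-injective : Injective _≡_ _≡_ π
  π-injective {a} {b} πa≡πb =
    lookup-injective key keys-distinct a b
      (keyLabel-injective 0<n (edge-key (edge-at a)) (edge-key (edge-at b))
                          (trans (sym (π-label a)) (trans (cong (λ i → suc (toℕ i)) πa≡πb) (π-label b))))

  labeling : Labeling Γ
  labeling = injective⇒permutation π π-injective

  vsum≡vertexSum : ∀ w → vsum Γ labeling w ≡ vertexSum w
  vsum≡vertexSum w =
    trans (cong sum (map-cong (λ e → cong (λ ℓ → if incident w (lookup G e) then ℓ else 0) (π-label e)) (allFin (length G))))
          (sum-map-lookup (term w) G)

  labeling-antimagic : IsLocalAntimagic Γ labeling
  labeling-antimagic e eq =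
    endpoint-sums-differ (edge-at e) (trans (sym (vsum≡vertexSum (proj₁ (lookup G e)))) (trans eq (vsum≡vertexSum (proj₂ (lookup G e)))))

  labeling-colors : colorNumber Γ labeling ≤ 3
  labeling-colors = colorNumber-≤ Γ labeling (A ∷ B ∷ C ∷ []) λ {w} w∈ →
    subst (_∈ A ∷ B ∷ C ∷ []) (sym (vsum≡vertexSum w)) (value (All.lookup all-vertices w∈))
    where
    value : ∀ {w} → Vertex w → vertexSum w ∈ A ∷ B ∷ C ∷ []
    value (u-vertex x∈K) = here (vertexSum-u x∈K)
    value (v-vertex y∈K) = there (here (vertexSum-v y∈K))
    value (layer ℓ)      = there (there (here (vertexSum-layer ℓ)))

  -- the middle index of M, fixed by the mirror
  centre : ℕ
  centre = suc (r * m + s)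

  mirror-centre : mirror centre ≡ centre
  mirror-centre = trans (cong (_∸ centre) (lemma r s)) (ℕ.m+n∸m≡n centre centre)
    where
    lemma : ∀ r s → (2 * r + 1) * (2 * s + 1) + 1 ≡ suc (r * (2 * s + 1) + s) + suc (r * (2 * s + 1) + s)
    lemma = solve-∀

  s<m : s < m
  s<m = ℕ.≤-trans (ℕ.m≤m+n (suc s) s) (ℕ.≤-reflexive (lemma s))
    where
    lemma : ∀ s → suc s + s ≡ 2 * s + 1
    lemma = solve-∀

  centre∈K : centre ∈ [ 1 ⋯ K′ ]
  centre∈K = ∈-⋯ 0 K′ K′ refl (proj₂ (pair-index s<m))

  centre∈M : centre ∈ M n r s
  centre∈M = ∈-⋯ (r * m) m ((r + 1) * m) M-end s<m

  1∈L : 1 ∈ [ 1 ⋯ 2 * n ]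
  1∈L = ∈-⋯ 0 (2 * n) (2 * n) refl (ℕ.≤-trans 0<n (ℕ.m≤n*m n 2))

  X₁-edge : ∀ {e} → e ∈ pair 1 centre → e ∈ G
  X₁-edge e∈ = ∈-++⁺ʳ rungs (∈-++⁺ʳ quads (∈-concatMap 1∈L (∈-concatMap centre∈M e∈)))

  antimagic-colors : ∀ (g : Labeling Γ) → IsLocalAntimagic Γ g → 3 ≤ colorNumber Γ g
  antimagic-colors g g-antimagic =
    3≤colorNumber Γ g X₁∈ (∈-++⁺ˡ (∈-map⁺ u centre∈K)) (∈-++⁺ʳ (map u [ 1 ⋯ K′ ]) (∈-++⁺ˡ (∈-map⁺ v centre∈K)))
      (differ (X₁-edge (here refl)))
      (subst (λ i → vsum Γ g (X 1) ≢ vsum Γ g (v i)) mirror-centre (differ (X₁-edge (there (here refl)))))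
      (differ (∈-++⁺ˡ (∈-map⁺ (λ i → (u i , v i)) centre∈K)))
    where
    differ : ∀ {x y} → (x , y) ∈ G → vsum Γ g x ≢ vsum Γ g y
    differ = antimagic-endpoints Γ g g-antimagic
    X₁∈ : X 1 ∈ Gverts n r s
    X₁∈ = ∈-++⁺ʳ (map u [ 1 ⋯ K′ ]) (∈-++⁺ʳ (map v [ 1 ⋯ K′ ])
            (∈-++⁺ʳ (concatMap (λ a → map (Y a) [ 1 ⋯ 2 * n ]) [ 1 ⋯ r ])
              (∈-++⁺ʳ (concatMap (λ a → map (Z a) [ 1 ⋯ 2 * n ]) [ 1 ⋯ r ]) (∈-map⁺ X 1∈L))))

  χla≡3 : χla≡ Γ 3
  χla≡3 = (labeling , labeling-antimagic , ℕ.≤-antisym labeling-colors (antimagic-colors labeling labeling-antimagic))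
        , antimagic-colors

theorem2p2 : (n r s : ℕ) → 1 ≤ n → 1 ≤ r → 1 ≤ s → χla≡ (G2n n r s) 3
theorem2p2 (suc n′) r s _ _ _ = Theorem.χla≡3 (suc n′) r s n′ refl
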